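{- Let $\lambda=(\lambda_1,\dots,\lambda_N)$ be a partition with $\lambda_1\geq\cdots\geq\lambda_N\geq 1$, let $\lambda^*$ be its extended Young diagram, and let $\{p_{i,j}(\theta)\}_{(i,j)\in\lambda^*}$ be the functions of non-zero indeterminates $\{\theta_{i,j}\}_{(i,j)\in\lambda^*}$ determined by the identities $$\det\Big(\big(p_{a+i-1,b+j-1}(\theta)\big)_{1\leq i,j\leq n_{a,b}}\Big)=\theta_{a,b}\qquad\text{for all }(a,b)\in\lambda^*.$$ Let $\{x_{i,j}\}_{(i,j)\in\lambda}$ be indeterminates and substitute $$\theta_{i,j}=1\ \text{ for }(i,j)\in\lambda^*\setminus\lambda,\qquad \theta_{a,b}=\prod_{r=0}^{n_{a,b}-1}\ \prod_{(i,j)\in\lambda_{a+r,b+r}} x_{i,j}\ \text{ for }(a,b)\in\lambda .$$ Then under this substitution, for every $(a,b)\in\lambda^*$, $p_{a,b}(\theta)$ becomes the Bessenrodt–Stanley polynomial $p_{a,b}(x)$, where $$p_{a,b}(x)=1\ \text{ if }(a,b)\in\lambda^*\setminus\lambda,\qquad p_{a,b}(x)=\sum_{\mu\subseteq\lambda_{a,b}}\ \prod_{(r,s)\in\lambda_{a,b}\setminus\mu}x_{r,s}\ \text{ if }(a,b)\in\lambda,$$ the sum running over all sub-diagrams $\mu$ of $\lambda_{a,b}$. In particular all denominators cancel and $p_{a,b}(\theta)$ becomes a polynomial in the $x_{i,j}$.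
   Context: The Young diagram of $\lambda$ is drawn with rows $1,\dots,N$ from top to bottom, left-justified; its boxes are the pairs $(i,j)$ with $1\le i\le N$, $1\le j\le\lambda_i$. The extended Young diagram $\lambda^*$ is obtained by adjoining to $\lambda$ a border strip from the end of the first row to the end of the first column: $\lambda^*_1=\lambda_1+1$ and $\lambda^*_i=\lambda_{i-1}+1$ for $i=2,\dots,N+1$. For $(a,b)\in\lambda^*$, $n_{a,b}\geq1$ is the largest $n$ such that the square $\{(i,j): a\le i\le a+n-1,\ b\le j\le b+n-1\}$ is contained in $\lambda^*$. The paper asserts that the determinant identities determine the $p_{i,j}(\theta)$ uniquely. For a box $(a,b)$, $\lambda_{a,b}=\{(i,j)\in\lambda: i\ge a,\ j\ge b\}$ (the part of $\lambda$ weakly south-east of $(a,b)$; empty if $(a,b)\notin\lambda$). A sub-diagram $\mu$ of $\lambda_{a,b}$ is a subset $\mu\subseteq\lambda_{a,b}$ (possibly empty or all of $\lambda_{a,b}$) forming a Young diagram with corner at $(a,b)$, i.e. whenever $(r,s)\in\mu$, every $(r',s')$ with $a\le r'\le r$, $b\le s'\le s$ lies in $\mu$. -}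

module Defs where

open import Level using (Level)
open import Data.Bool using (Bool; true; false; _∧_; _∨_; if_then_else_)
open import Data.Nat using (ℕ; zero; suc; _+_; _∸_; _≤ᵇ_; _≡ᵇ_; _≥_)
open import Data.Fin using (Fin; toℕ; punchIn) renaming (zero to fzero; suc to fsuc)
open import Data.List using (List; []; _∷_; length; map; concatMap; filterᵇ; foldr; upTo)
open import Data.Bool.ListAction using (all; any)
open import Data.List.Relation.Unary.All using (All)
open import Data.List.Relation.Unary.Linked using (Linked)
open import Data.Product using (_×_; _,_)
open import Relation.Binary.PropositionalEquality using (_≢_)
open import Algebra.Bundles using (CommutativeRing)

-- Partitions, encoded as lists of row lengths (λ₁ ∷ λ₂ ∷ … ∷ λ_N ∷ [])

IsPartition : List ℕ → Set
IsPartition l = (l ≢ []) × All (λ k → k ≥ 1) l × Linked _≥_ l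

-- row l i = λ_i  (1-indexed; 0 for i = 0 or i > N)
row : List ℕ → ℕ → ℕ
row l zero = zero
row [] (suc i) = zero
row (x ∷ l) (suc zero) = x
row (x ∷ l) (suc (suc i)) = row l (suc i)

fromTo : ℕ → ℕ → List ℕ
fromTo lo hi = map (lo +_) (upTo (suc hi ∸ lo))

inLam : List ℕ → ℕ → ℕ → Bool
inLam l i j = (1 ≤ᵇ i) ∧ (i ≤ᵇ length l) ∧ (1 ≤ᵇ j) ∧ (j ≤ᵇ row l i)

-- row lengths of the extended diagram λ*:
-- λ*_1 = λ_1 + 1,  λ*_i = λ_{i-1} + 1 for 2 ≤ i ≤ N+1, 0 otherwise
rowStar : List ℕ → ℕ → ℕ
rowStar l zero = zero
rowStar l (suc zero) = suc (row l 1)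
rowStar l (suc (suc i)) = if suc (suc i) ≤ᵇ suc (length l) then suc (row l (suc i)) else zero

inStar : List ℕ → ℕ → ℕ → Bool
inStar l i j = (1 ≤ᵇ i) ∧ (i ≤ᵇ suc (length l)) ∧ (1 ≤ᵇ j) ∧ (j ≤ᵇ rowStar l i)

squareIn : List ℕ → ℕ → ℕ → ℕ → Bool
squareIn l a b n =
  all (λ i → all (λ j → inStar l i j) (fromTo b (b + n ∸ 1))) (fromTo a (a + n ∸ 1))

largestSq : List ℕ → ℕ → ℕ → ℕ → ℕ
largestSq l a b zero = zero
largestSq l a b (suc k) = if squareIn l a b (suc k) then suc k else largestSq l a b k

-- n_{a,b}: largest n such that the n×n square at (a , b) lies in λ*.
-- (λ* has N+1 rows, so N+1 bounds every such n.)
nab : List ℕ → ℕ → ℕ → ℕ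
nab l a b = largestSq l a b (suc (length l))

boxes : List ℕ → List (ℕ × ℕ)
boxes l = concatMap (λ i → map (λ j → (i , j)) (fromTo 1 (row l i))) (fromTo 1 (length l))

lamSE : List ℕ → ℕ → ℕ → List (ℕ × ℕ)
lamSE l a b = filterᵇ (λ { (i , j) → (a ≤ᵇ i) ∧ (b ≤ᵇ j) }) (boxes l)

subsets : {A : Set} → List A → List (List A × List A)
subsets [] = ([] , []) ∷ []
subsets (x ∷ xs) = concatMap (λ { (s , c) → (x ∷ s , c) ∷ (s , x ∷ c) ∷ [] }) (subsets xs)

eqBox : ℕ × ℕ → ℕ × ℕ → Bool
eqBox (i , j) (i' , j') = (i ≡ᵇ i') ∧ (j ≡ᵇ j')

memBox : ℕ × ℕ → List (ℕ × ℕ) → Bool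
memBox p μ = any (eqBox p) μ

isSubdiagram : ℕ → ℕ → List (ℕ × ℕ) → Bool
isSubdiagram a b μ =
  all (λ { (r , s) → all (λ r' → all (λ s' → memBox (r' , s') μ) (fromTo b s)) (fromTo a r) }) μ

module _ {c ℓ : Level} (R : CommutativeRing c ℓ) where
  open CommutativeRing R using (Carrier; 0#; 1#; -_) renaming (_+_ to _+R_; _*_ to _*R_)

  prodL : List Carrier → Carrier
  prodL = foldr _*R_ 1#

  sumL : List Carrier → Carrier
  sumL = foldr _+R_ 0#

  sumFin : (n : ℕ) → (Fin n → Carrier) → Carrier
  sumFin zero f = 0#
  sumFin (suc n) f = f fzero +R sumFin n (λ k → f (fsuc k))

  altSign : ℕ → Carrier
  altSign zero = 1#
  altSign (suc k) = - altSign k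

  det : (n : ℕ) → (Fin n → Fin n → Carrier) → Carrier
  det zero M = 1#
  det (suc n) M =
    sumFin (suc n) (λ j → altSign (toℕ j) *R (M fzero j *R det n (λ i k → M (fsuc i) (punchIn j k))))

  prodBoxes : (ℕ → ℕ → Carrier) → List (ℕ × ℕ) → Carrier
  prodBoxes x bs = prodL (map (λ { (i , j) → x i j }) bs)

  -- Bessenrodt–Stanley polynomial p_{a,b}(x):
  --   Σ_{μ ⊆ λ_{a,b} sub-diagram} ∏_{(r,s) ∈ λ_{a,b} ∖ μ} x_{r,s}   if (a,b) ∈ λ,
  --   1 if (a,b) ∈ λ* ∖ λ   (0 outside λ*, never used)
  BS : List ℕ → (ℕ → ℕ → Carrier) → ℕ → ℕ → Carrier
  BS l x a b =
    if inLam l a b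
    then sumL (map (λ { (μ , comp) → if isSubdiagram a b μ then prodBoxes x comp else 0# })
                   (subsets (lamSE l a b)))
    else (if inStar l a b then 1# else 0#)

  thetaX : List ℕ → (ℕ → ℕ → Carrier) → ℕ → ℕ → Carrier
  thetaX l x a b =
    if inLam l a b
    then prodL (map (λ r → prodBoxes x (lamSE l (a + r) (b + r))) (upTo (nab l a b)))
    else 1#

module Submission where

-- Record a sub-diagram μ ⊆ λ_{a,b} by the columns at which its rows end: the Bessenrodt–Stanley
-- polynomial becomes an iterated sum over the rows, G(s, E, c) = gfRows s E c, where rows s, …, E-1
-- are cut at column c.  Separating the sub-diagrams whose last row is empty gives
--   G(s, d+1, c) = x_{d,c+1} ⋯ x_{d,λ_d} · G(s, d, c) + G(s, d+1, c+1).
-- On the largest square at (a, b) the entry p_{a+i,b+j} is G(a+i, λ'_{b+j-1} + 1, b+j-1) (entries of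
-- λ* ∖ λ included), and iterating the recurrence writes column j as a monomial times column j of the
-- unitriangular matrix G(a+i, a+j, b+j-1) plus a combination of its later columns; maximality of the
-- square makes what is left after the last column vanish.  Column reduction leaves the product of
-- the monomials, and the j-th one is the product of the x over λ_{a+j,b+j}.

open import Level using (Level; _⊔_)
open import Algebra.Bundles using (CommutativeRing)
open import Data.Bool using (Bool; true; false; T; _∧_; _∨_; if_then_else_)
open import Data.Bool.Properties using (∧-assoc; ∧-identityʳ; ∧-zeroʳ; ∨-assoc; ∨-identityʳ)
open import Data.Bool.ListAction using (all; any)
open import Data.Empty using (⊥-elim)
open import Data.Unit using (⊤)
open import Data.Fin using (Fin; toℕ; punchIn) renaming (zero to fzero; suc to fsuc)
open import Data.List using (List; []; _∷_; [_]; _++_; length; map; concatMap; filterᵇ; upTo; applyUpTo; null; _∷ʳ_)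
import Data.List.Properties as Listₚ
open import Data.List.Relation.Unary.All as All using (All; []; _∷_)
import Data.List.Relation.Unary.All.Properties as Allₚ
open import Data.List.Relation.Unary.Linked as Linked using (Linked; []; _∷_)
open import Data.Nat using (ℕ; zero; suc; _+_; _∸_; _≤_; _<_; _≥_; z≤n; s≤s; _≤ᵇ_; _<ᵇ_; _≡ᵇ_; _≤?_; _≟_)
import Data.Nat.Properties as ℕₚ
open ℕₚ using (≤-refl; ≤-trans; <-trans; ≤-<-trans; <-≤-trans; ≤-pred; n<1+n; n≤1+n; <-irrefl; m≤m+n; m≤n+m; ≰⇒>; suc-injective)
open import Data.Product using (Σ; _×_; _,_; proj₁; proj₂)
open import Function using (_∘_)
open import Relation.Binary.Definitions using (tri<; tri≈; tri>)
import Relation.Binary.PropositionalEquality as ≡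
open ≡ using (_≡_; _≢_)
open import Relation.Nullary using (¬_; yes; no)
open import Relation.Nullary.Decidable.Core using (T?)
open import Defs

T⇒≡true : ∀ {b} → T b → b ≡ true
T⇒≡true {true} _ = ≡.refl

¬T⇒≡false : ∀ {b} → ¬ T b → b ≡ false
¬T⇒≡false {true} h = ⊥-elim (h _)
¬T⇒≡false {false} _ = ≡.refl

if-true : ∀ {a} {A : Set a} {b} {x y : A} → b ≡ true → (if b then x else y) ≡ x
if-true ≡.refl = ≡.refl

if-false : ∀ {a} {A : Set a} {b} {x y : A} → b ≡ false → (if b then x else y) ≡ y
if-false ≡.refl = ≡.refl

∧≡true⇒ : ∀ {a b} → a ∧ b ≡ true → a ≡ true × b ≡ true
∧≡true⇒ {true} {true} _ = ≡.refl , ≡.refl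

≤ᵇ-true : ∀ {m n} → m ≤ n → (m ≤ᵇ n) ≡ true
≤ᵇ-true p = T⇒≡true (ℕₚ.≤⇒≤ᵇ p)

≤ᵇ-false : ∀ {m n} → n < m → (m ≤ᵇ n) ≡ false
≤ᵇ-false {m} {n} p = ¬T⇒≡false (λ t → ℕₚ.<⇒≱ p (ℕₚ.≤ᵇ⇒≤ m n t))

≤ᵇ-true⁻ : ∀ {m n} → (m ≤ᵇ n) ≡ true → m ≤ n
≤ᵇ-true⁻ {m} {n} e = ℕₚ.≤ᵇ⇒≤ m n (≡.subst T (≡.sym e) _)

<ᵇ-true : ∀ {m n} → m < n → (m <ᵇ n) ≡ true
<ᵇ-true p = T⇒≡true (ℕₚ.<⇒<ᵇ p)

<ᵇ-false : ∀ {m n} → n ≤ m → (m <ᵇ n) ≡ false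
<ᵇ-false {m} {n} p = ¬T⇒≡false (λ t → ℕₚ.<⇒≱ (ℕₚ.<ᵇ⇒< m n t) p)

≡ᵇ-true : ∀ {m n} → m ≡ n → (m ≡ᵇ n) ≡ true
≡ᵇ-true {m} {n} p = T⇒≡true (ℕₚ.≡⇒≡ᵇ m n p)

≡ᵇ-false : ∀ {m n} → m ≢ n → (m ≡ᵇ n) ≡ false
≡ᵇ-false {m} {n} p = ¬T⇒≡false (λ t → p (ℕₚ.≡ᵇ⇒≡ m n t))

countFrom : ℕ → ℕ → List ℕ
countFrom lo zero = []
countFrom lo (suc k) = lo ∷ countFrom (suc lo) k

applyUpTo≡countFrom : ∀ k lo (g : ℕ → ℕ) → (∀ m → g m ≡ lo + m) → applyUpTo g k ≡ countFrom lo k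
applyUpTo≡countFrom zero lo g h = ≡.refl
applyUpTo≡countFrom (suc k) lo g h =
  ≡.cong₂ _∷_ (≡.trans (h 0) (ℕₚ.+-identityʳ lo))
              (applyUpTo≡countFrom k (suc lo) (g ∘ suc) (λ m → ≡.trans (h (suc m)) (ℕₚ.+-suc lo m)))

fromTo≡countFrom : ∀ lo hi → fromTo lo hi ≡ countFrom lo (suc hi ∸ lo)
fromTo≡countFrom lo hi =
  ≡.trans (Listₚ.map-upTo (lo +_) (suc hi ∸ lo)) (applyUpTo≡countFrom (suc hi ∸ lo) lo (lo +_) (λ _ → ≡.refl))

fromTo-step : ∀ {lo hi} → lo ≤ hi → fromTo lo hi ≡ lo ∷ fromTo (suc lo) hi
fromTo-step {lo} {hi} p = ≡.trans (fromTo≡countFrom lo hi)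
  (≡.trans (≡.cong (countFrom lo) (ℕₚ.+-∸-assoc 1 p)) (≡.cong (lo ∷_) (≡.sym (fromTo≡countFrom (suc lo) hi))))

fromTo-empty : ∀ {lo hi} → hi < lo → fromTo lo hi ≡ []
fromTo-empty {lo} {hi} p = ≡.trans (fromTo≡countFrom lo hi) (≡.cong (countFrom lo) (ℕₚ.m≤n⇒m∸n≡0 p))

fromTo-single : ∀ a → fromTo a a ≡ a ∷ []
fromTo-single a = ≡.trans (fromTo-step (≤-refl {a})) (≡.cong (a ∷_) (fromTo-empty (n<1+n a)))

All-countFrom : ∀ k lo → All (λ z → lo ≤ z × z < lo + k) (countFrom lo k)
All-countFrom zero lo = []
All-countFrom (suc k) lo = (≤-refl , ≡.subst (lo <_) (≡.sym (ℕₚ.+-suc lo k)) (s≤s (m≤m+n lo k))) ∷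
  All.map (λ {z} (p , q) → ≤-trans (n≤1+n lo) p , ≡.subst (z <_) (≡.sym (ℕₚ.+-suc lo k)) q) (All-countFrom k (suc lo))

All-fromTo : ∀ lo hi → All (λ z → lo ≤ z × z ≤ hi) (fromTo lo hi)
All-fromTo lo hi with lo ≤? suc hi
... | yes p = ≡.subst (All _) (≡.sym (fromTo≡countFrom lo hi))
  (All.map (λ {z} (q , r) → q , ≤-pred (≡.subst (z <_) (ℕₚ.m+[n∸m]≡n p) r)) (All-countFrom (suc hi ∸ lo) lo))
... | no np = ≡.subst (All _) (≡.sym (fromTo-empty (ℕₚ.<⇒≤ (≰⇒> np)))) []

all-countFrom⁻ : ∀ (f : ℕ → Bool) {lo k} → all f (countFrom lo k) ≡ true → ∀ {i} → i < k → f (lo + i) ≡ true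
all-countFrom⁻ f {lo} h {zero} (s≤s _) = ≡.subst (λ w → f w ≡ true) (≡.sym (ℕₚ.+-identityʳ lo)) (proj₁ (∧≡true⇒ h))
all-countFrom⁻ f {lo} h {suc i} (s≤s i<k) =
  ≡.subst (λ w → f w ≡ true) (≡.sym (ℕₚ.+-suc lo i)) (all-countFrom⁻ f (proj₂ (∧≡true⇒ {f lo} h)) i<k)

all-countFrom⁺ : ∀ (f : ℕ → Bool) lo k → (∀ {i} → i < k → f (lo + i) ≡ true) → all f (countFrom lo k) ≡ true
all-countFrom⁺ f lo zero h = ≡.refl
all-countFrom⁺ f lo (suc k) h = ≡.cong₂ _∧_
  (≡.subst (λ w → f w ≡ true) (ℕₚ.+-identityʳ lo) (h (s≤s z≤n)))
  (all-countFrom⁺ f (suc lo) k (λ {i} i<k → ≡.subst (λ w → f w ≡ true) (ℕₚ.+-suc lo i) (h (s≤s i<k))))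

all-true : ∀ {A : Set} {f : A → Bool} {xs} → All (λ z → f z ≡ true) xs → all f xs ≡ true
all-true [] = ≡.refl
all-true (p ∷ ps) rewrite p = all-true ps

any-false : ∀ {A : Set} {f : A → Bool} {xs} → All (λ z → f z ≡ false) xs → any f xs ≡ false
any-false [] = ≡.refl
any-false (p ∷ ps) rewrite p = any-false ps

all-++ : ∀ {A : Set} (p : A → Bool) xs ys → all p (xs ++ ys) ≡ all p xs ∧ all p ys
all-++ p [] ys = ≡.refl
all-++ p (x ∷ xs) ys = ≡.trans (≡.cong (p x ∧_) (all-++ p xs ys)) (≡.sym (∧-assoc (p x) (all p xs) (all p ys)))

any-++ : ∀ {A : Set} (p : A → Bool) xs ys → any p (xs ++ ys) ≡ any p xs ∨ any p ys
any-++ p [] ys = ≡.refl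
any-++ p (x ∷ xs) ys = ≡.trans (≡.cong (p x ∨_) (any-++ p xs ys)) (≡.sym (∨-assoc (p x) (any p xs) (any p ys)))

all-cong : ∀ {A : Set} {f g : A → Bool} xs → (∀ z → f z ≡ g z) → all f xs ≡ all g xs
all-cong [] h = ≡.refl
all-cong (x ∷ xs) h = ≡.cong₂ _∧_ (h x) (all-cong xs h)

all-congᴬ : ∀ {A : Set} {Q : A → Set} {f g : A → Bool} {xs} → All Q xs → (∀ {z} → Q z → f z ≡ g z) → all f xs ≡ all g xs
all-congᴬ [] h = ≡.refl
all-congᴬ (q ∷ qs) h = ≡.cong₂ _∧_ (h q) (all-congᴬ qs h)

all-∧ : ∀ {A : Set} (f g : A → Bool) xs → all (λ z → f z ∧ g z) xs ≡ all f xs ∧ all g xs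
all-∧ f g [] = ≡.refl
all-∧ f g (x ∷ xs) = ≡.trans (≡.cong ((f x ∧ g x) ∧_) (all-∧ f g xs)) (interchange (f x) (g x) (all f xs) (all g xs))
  where
  interchange : ∀ a b c d → (a ∧ b) ∧ (c ∧ d) ≡ (a ∧ c) ∧ (b ∧ d)
  interchange true true c d = ≡.refl
  interchange true false c d = ≡.sym (∧-zeroʳ c)
  interchange false b c d = ≡.refl

all-fromTo-downClosed : (p : ℕ → Bool) → (∀ {s s′} → s′ ≤ s → p s ≡ true → p s′ ≡ true) →
  ∀ {lo hi} → lo ≤ hi → all p (fromTo lo hi) ≡ p hi
all-fromTo-downClosed p down {lo} lo≤hi with ℕₚ.m≤n⇒∃[o]m+o≡n lo≤hi
... | k , ≡.refl = go k lo
  where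
  go : ∀ k lo → all p (fromTo lo (lo + k)) ≡ p (lo + k)
  go zero lo rewrite ℕₚ.+-identityʳ lo | fromTo-single lo = ∧-identityʳ (p lo)
  go (suc k) lo rewrite fromTo-step (m≤m+n lo (suc k)) | ℕₚ.+-suc lo k | go k (suc lo) with p (suc lo + k) in e
  ... | true = ≡.cong (_∧ true) (down (ℕₚ.m≤n⇒m≤1+n (m≤m+n lo k)) e)
  ... | false = ∧-zeroʳ (p lo)

filterᵇ-++ : ∀ {A : Set} (p : A → Bool) xs ys → filterᵇ p (xs ++ ys) ≡ filterᵇ p xs ++ filterᵇ p ys
filterᵇ-++ p = Listₚ.filter-++ (T? ∘ p)

filterᵇ-concatMap : ∀ {A B : Set} (p : B → Bool) (f : A → List B) xs →
  filterᵇ p (concatMap f xs) ≡ concatMap (filterᵇ p ∘ f) xs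
filterᵇ-concatMap p f [] = ≡.refl
filterᵇ-concatMap p f (x ∷ xs) =
  ≡.trans (filterᵇ-++ p (f x) (concatMap f xs)) (≡.cong (filterᵇ p (f x) ++_) (filterᵇ-concatMap p f xs))

filterᵇ-map : ∀ {A B : Set} (p : B → Bool) (f : A → B) xs → filterᵇ p (map f xs) ≡ map f (filterᵇ (p ∘ f) xs)
filterᵇ-map p f [] = ≡.refl
filterᵇ-map p f (x ∷ xs) with p (f x)
... | true = ≡.cong (f x ∷_) (filterᵇ-map p f xs)
... | false = filterᵇ-map p f xs

filterᵇ-fromTo : ∀ {lo c} hi → lo ≤ c → filterᵇ (c ≤ᵇ_) (fromTo lo hi) ≡ fromTo c hi
filterᵇ-fromTo {lo} hi lo≤c with ℕₚ.m≤n⇒∃[o]m+o≡n lo≤c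
... | d , ≡.refl = go d lo
  where
  go : ∀ d lo → filterᵇ ((lo + d) ≤ᵇ_) (fromTo lo hi) ≡ fromTo (lo + d) hi
  go zero lo rewrite ℕₚ.+-identityʳ lo =
    Listₚ.filter-all (T? ∘ (lo ≤ᵇ_)) (All.map (λ (lo≤z , _) → ℕₚ.≤⇒≤ᵇ lo≤z) (All-fromTo lo hi))
  go (suc d) lo with lo ≤? hi
  ... | yes lo≤hi = begin
    filterᵇ ((lo + suc d) ≤ᵇ_) (fromTo lo hi)               ≡⟨ ≡.cong (filterᵇ _) (fromTo-step lo≤hi) ⟩
    filterᵇ ((lo + suc d) ≤ᵇ_) (lo ∷ fromTo (suc lo) hi)    ≡⟨ Listₚ.filter-reject (T? ∘ ((lo + suc d) ≤ᵇ_)) {lo} {fromTo (suc lo) hi} lo-rejected ⟩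
    filterᵇ ((lo + suc d) ≤ᵇ_) (fromTo (suc lo) hi)         ≡⟨ ≡.subst (λ c → filterᵇ (c ≤ᵇ_) (fromTo (suc lo) hi) ≡ fromTo c hi)
                                                                      (≡.sym (ℕₚ.+-suc lo d)) (go d (suc lo)) ⟩
    fromTo (lo + suc d) hi                                   ∎
    where
    open ≡.≡-Reasoning
    lo-rejected : ¬ T ((lo + suc d) ≤ᵇ lo)
    lo-rejected t = ℕₚ.<⇒≱ (ℕₚ.m<m+n lo (s≤s z≤n)) (ℕₚ.≤ᵇ⇒≤ _ _ t)
  ... | no lo≰hi rewrite fromTo-empty (≰⇒> lo≰hi)
                      | fromTo-empty {lo + suc d} {hi} (<-≤-trans (≰⇒> lo≰hi) (m≤m+n lo (suc d))) = ≡.refl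

punchInℕ : ℕ → ℕ → ℕ
punchInℕ zero m = suc m
punchInℕ (suc j) zero = zero
punchInℕ (suc j) (suc m) = suc (punchInℕ j m)

punchOutℕ : ℕ → ℕ → ℕ
punchOutℕ zero zero = zero
punchOutℕ zero (suc q) = q
punchOutℕ (suc j) zero = zero
punchOutℕ (suc j) (suc q) = suc (punchOutℕ j q)

swapℕ : ℕ → ℕ → ℕ
swapℕ zero zero = 1
swapℕ zero (suc zero) = zero
swapℕ zero (suc (suc j)) = suc (suc j)
swapℕ (suc k) zero = zero
swapℕ (suc k) (suc j) = suc (swapℕ k j)

private
  ≢-pred : ∀ {m n} → suc m ≢ suc n → m ≢ n
  ≢-pred 1+m≢1+n = 1+m≢1+n ∘ ≡.cong suc

toℕ-punchIn : ∀ {n} (j : Fin (suc n)) (k : Fin n) → toℕ (punchIn j k) ≡ punchInℕ (toℕ j) (toℕ k)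
toℕ-punchIn fzero k = ≡.refl
toℕ-punchIn (fsuc j) fzero = ≡.refl
toℕ-punchIn (fsuc j) (fsuc k) = ≡.cong suc (toℕ-punchIn j k)

punchInℕᵢ≢i : ∀ j k → punchInℕ j k ≢ j
punchInℕᵢ≢i zero k ()
punchInℕᵢ≢i (suc j) zero ()
punchInℕᵢ≢i (suc j) (suc k) e = punchInℕᵢ≢i j k (suc-injective e)

punchInℕ-injective : ∀ j k k′ → punchInℕ j k ≡ punchInℕ j k′ → k ≡ k′
punchInℕ-injective zero k k′ e = suc-injective e
punchInℕ-injective (suc j) zero zero e = ≡.refl
punchInℕ-injective (suc j) (suc k) (suc k′) e = ≡.cong suc (punchInℕ-injective j k k′ (suc-injective e))

punchInℕ-< : ∀ {n} j k → k < n → punchInℕ j k < suc n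
punchInℕ-< j k k<n = s≤s (≤-trans (punchInℕ≤suc j k) k<n)
  where
  punchInℕ≤suc : ∀ j k → punchInℕ j k ≤ suc k
  punchInℕ≤suc zero k = ≤-refl
  punchInℕ≤suc (suc j) zero = z≤n
  punchInℕ≤suc (suc j) (suc k) = s≤s (punchInℕ≤suc j k)

punchInℕ-punchOutℕ : ∀ j q → q ≢ j → punchInℕ j (punchOutℕ j q) ≡ q
punchInℕ-punchOutℕ zero zero q≢j = ⊥-elim (q≢j ≡.refl)
punchInℕ-punchOutℕ zero (suc q) _ = ≡.refl
punchInℕ-punchOutℕ (suc j) zero _ = ≡.refl
punchInℕ-punchOutℕ (suc j) (suc q) q≢j = ≡.cong suc (punchInℕ-punchOutℕ j q (≢-pred q≢j))

punchOutℕ-< : ∀ {n} j q → q < suc n → q ≢ j → j < suc n → punchOutℕ j q < n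
punchOutℕ-< zero zero _ q≢j _ = ⊥-elim (q≢j ≡.refl)
punchOutℕ-< zero (suc q) (s≤s q<n) _ _ = q<n
punchOutℕ-< {zero} (suc j) zero _ _ (s≤s ())
punchOutℕ-< {suc n} (suc j) zero _ _ _ = s≤s z≤n
punchOutℕ-< {suc n} (suc j) (suc q) (s≤s q<n) q≢j (s≤s j<n) = s≤s (punchOutℕ-< j q q<n (≢-pred q≢j) j<n)

punchInℕ-adjacent : ∀ k m → m ≢ k → punchInℕ k m ≡ punchInℕ (suc k) m
punchInℕ-adjacent zero zero m≢k = ⊥-elim (m≢k ≡.refl)
punchInℕ-adjacent zero (suc m) _ = ≡.refl
punchInℕ-adjacent (suc k) zero _ = ≡.refl
punchInℕ-adjacent (suc k) (suc m) m≢k = ≡.cong suc (punchInℕ-adjacent k m (≢-pred m≢k))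

punchInℕ-self : ∀ k → punchInℕ k k ≡ suc k
punchInℕ-self zero = ≡.refl
punchInℕ-self (suc k) = ≡.cong suc (punchInℕ-self k)

punchInℕ-suc-self : ∀ k → punchInℕ (suc k) k ≡ k
punchInℕ-suc-self zero = ≡.refl
punchInℕ-suc-self (suc k) = ≡.cong suc (punchInℕ-suc-self k)

punchInℕ-suc-punchOutℕ : ∀ j k → j ≢ k → j ≢ suc k → punchInℕ j (suc (punchOutℕ j k)) ≡ suc k
punchInℕ-suc-punchOutℕ zero zero j≢k _ = ⊥-elim (j≢k ≡.refl)
punchInℕ-suc-punchOutℕ zero (suc k) _ _ = ≡.refl
punchInℕ-suc-punchOutℕ (suc zero) zero _ j≢1+k = ⊥-elim (j≢1+k ≡.refl)
punchInℕ-suc-punchOutℕ (suc (suc j)) zero _ _ = ≡.refl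
punchInℕ-suc-punchOutℕ (suc j) (suc k) j≢k j≢1+k = ≡.cong suc (punchInℕ-suc-punchOutℕ j k (≢-pred j≢k) (≢-pred j≢1+k))

suc-punchOutℕ-< : ∀ {n} j k → suc k < suc n → j < suc n → j ≢ k → j ≢ suc k → suc (punchOutℕ j k) < n
suc-punchOutℕ-< zero zero _ _ j≢k _ = ⊥-elim (j≢k ≡.refl)
suc-punchOutℕ-< zero (suc k) (s≤s k<n) _ _ _ = k<n
suc-punchOutℕ-< (suc zero) zero _ _ _ j≢1+k = ⊥-elim (j≢1+k ≡.refl)
suc-punchOutℕ-< (suc (suc j)) zero _ (s≤s j<n) _ _ = <-≤-trans (s≤s (s≤s z≤n)) j<n
suc-punchOutℕ-< {suc n} (suc j) (suc k) (s≤s k<n) (s≤s j<n) j≢k j≢1+k =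
  s≤s (suc-punchOutℕ-< j k k<n j<n (≢-pred j≢k) (≢-pred j≢1+k))

swapℕ-left : ∀ k → swapℕ k k ≡ suc k
swapℕ-left zero = ≡.refl
swapℕ-left (suc k) = ≡.cong suc (swapℕ-left k)

swapℕ-right : ∀ k → swapℕ k (suc k) ≡ k
swapℕ-right zero = ≡.refl
swapℕ-right (suc k) = ≡.cong suc (swapℕ-right k)

swapℕ-other : ∀ k j → j ≢ k → j ≢ suc k → swapℕ k j ≡ j
swapℕ-other zero zero j≢k _ = ⊥-elim (j≢k ≡.refl)
swapℕ-other zero (suc zero) _ j≢1+k = ⊥-elim (j≢1+k ≡.refl)
swapℕ-other zero (suc (suc j)) _ _ = ≡.refl
swapℕ-other (suc k) zero _ _ = ≡.refl
swapℕ-other (suc k) (suc j) j≢k j≢1+k = ≡.cong suc (swapℕ-other k j (≢-pred j≢k) (≢-pred j≢1+k))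

swapℕ-punchInℕ-left : ∀ k m → swapℕ k (punchInℕ k m) ≡ punchInℕ (suc k) m
swapℕ-punchInℕ-left zero zero = ≡.refl
swapℕ-punchInℕ-left zero (suc m) = ≡.refl
swapℕ-punchInℕ-left (suc k) zero = ≡.refl
swapℕ-punchInℕ-left (suc k) (suc m) = ≡.cong suc (swapℕ-punchInℕ-left k m)

swapℕ-punchInℕ-right : ∀ k m → swapℕ k (punchInℕ (suc k) m) ≡ punchInℕ k m
swapℕ-punchInℕ-right zero zero = ≡.refl
swapℕ-punchInℕ-right zero (suc m) = ≡.refl
swapℕ-punchInℕ-right (suc k) zero = ≡.refl
swapℕ-punchInℕ-right (suc k) (suc m) = ≡.cong suc (swapℕ-punchInℕ-right k m)

swapℕ-punchInℕ : ∀ j k m → j ≢ k → j ≢ suc k → swapℕ k (punchInℕ j m) ≡ punchInℕ j (swapℕ (punchOutℕ j k) m)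
swapℕ-punchInℕ zero zero m j≢k _ = ⊥-elim (j≢k ≡.refl)
swapℕ-punchInℕ zero (suc k) m _ _ = ≡.refl
swapℕ-punchInℕ (suc zero) zero m _ j≢1+k = ⊥-elim (j≢1+k ≡.refl)
swapℕ-punchInℕ (suc (suc j)) zero zero _ _ = ≡.refl
swapℕ-punchInℕ (suc (suc j)) zero (suc zero) _ _ = ≡.refl
swapℕ-punchInℕ (suc (suc j)) zero (suc (suc m)) _ _ = ≡.refl
swapℕ-punchInℕ (suc j) (suc k) zero _ _ = ≡.refl
swapℕ-punchInℕ (suc j) (suc k) (suc m) j≢k j≢1+k = ≡.cong suc (swapℕ-punchInℕ j k m (≢-pred j≢k) (≢-pred j≢1+k))

module FiniteSums {c ℓ} (R : CommutativeRing c ℓ) where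

  open CommutativeRing R hiding (zero) renaming (_+_ to _⊕_; _*_ to _⊗_)
  open import Algebra.Properties.Ring ring using (-0#≈0#; -‿+-comm)
  open import Algebra.Properties.CommutativeSemigroup +-commutativeSemigroup using (interchange)
  open import Relation.Binary.Reasoning.Setoid setoid

  sum< : ℕ → (ℕ → Carrier) → Carrier
  sum< zero f = 0#
  sum< (suc n) f = f zero ⊕ sum< n (f ∘ suc)

  sum<-cong : ∀ n {f g : ℕ → Carrier} → (∀ {k} → k < n → f k ≈ g k) → sum< n f ≈ sum< n g
  sum<-cong zero h = refl
  sum<-cong (suc n) h = +-cong (h (s≤s z≤n)) (sum<-cong n (h ∘ s≤s))

  sum<-zero : ∀ n {f : ℕ → Carrier} → (∀ {k} → k < n → f k ≈ 0#) → sum< n f ≈ 0#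
  sum<-zero zero h = refl
  sum<-zero (suc n) h = trans (+-cong (h (s≤s z≤n)) (sum<-zero n (h ∘ s≤s))) (+-identityʳ 0#)

  sum<-+ : ∀ n (f g : ℕ → Carrier) → sum< n (λ k → f k ⊕ g k) ≈ sum< n f ⊕ sum< n g
  sum<-+ zero f g = sym (+-identityʳ 0#)
  sum<-+ (suc n) f g = trans (+-congˡ (sum<-+ n (f ∘ suc) (g ∘ suc))) (interchange _ _ _ _)

  sum<-*ˡ : ∀ n a (f : ℕ → Carrier) → sum< n (λ k → a ⊗ f k) ≈ a ⊗ sum< n f
  sum<-*ˡ zero a f = sym (zeroʳ a)
  sum<-*ˡ (suc n) a f = trans (+-congˡ (sum<-*ˡ n a (f ∘ suc))) (sym (distribˡ a _ _))

  sum<-neg : ∀ n (f : ℕ → Carrier) → sum< n (λ k → - f k) ≈ - sum< n f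
  sum<-neg zero f = sym -0#≈0#
  sum<-neg (suc n) f = trans (+-congˡ (sum<-neg n (f ∘ suc))) (-‿+-comm _ _)

  sum<-swapℕ : ∀ n k (f : ℕ → Carrier) → suc k < n → sum< n (f ∘ swapℕ k) ≈ sum< n f
  sum<-swapℕ (suc (suc n)) zero f _ = begin
    f 1 ⊕ (f 0 ⊕ rest)   ≈⟨ +-assoc _ _ _ ⟨
    (f 1 ⊕ f 0) ⊕ rest   ≈⟨ +-congʳ (+-comm _ _) ⟩
    (f 0 ⊕ f 1) ⊕ rest   ≈⟨ +-assoc _ _ _ ⟩
    f 0 ⊕ (f 1 ⊕ rest)   ∎
    where
    rest : Carrier
    rest = sum< n (f ∘ suc ∘ suc)
  sum<-swapℕ (suc n) (suc k) f (s≤s k<n) = +-congˡ (sum<-swapℕ n k (f ∘ suc) k<n)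

  sum<-cancellingPair : ∀ n k (f : ℕ → Carrier) → suc k < n → f k ⊕ f (suc k) ≈ 0# →
    (∀ {j} → j < n → j ≢ k → j ≢ suc k → f j ≈ 0#) → sum< n f ≈ 0#
  sum<-cancellingPair (suc (suc n)) zero f _ pair others = begin
    f 0 ⊕ (f 1 ⊕ sum< n (f ∘ suc ∘ suc))   ≈⟨ +-assoc _ _ _ ⟨
    (f 0 ⊕ f 1) ⊕ sum< n (f ∘ suc ∘ suc)   ≈⟨ +-cong pair (sum<-zero n (λ j<n → others (s≤s (s≤s j<n)) (λ ()) (λ ()))) ⟩
    0# ⊕ 0#                                ≈⟨ +-identityʳ 0# ⟩
    0#                                     ∎
  sum<-cancellingPair (suc n) (suc k) f (s≤s k<n) pair others = begin
    f 0 ⊕ sum< n (f ∘ suc)   ≈⟨ +-cong (others (s≤s z≤n) (λ ()) (λ ()))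
                                        (sum<-cancellingPair n k (f ∘ suc) k<n pair
                                          (λ j<n j≢k j≢1+k → others (s≤s j<n) (j≢k ∘ suc-injective) (j≢1+k ∘ suc-injective))) ⟩
    0# ⊕ 0#                  ≈⟨ +-identityʳ 0# ⟩
    0#                       ∎

  sumFin≈sum< : ∀ n (g : Fin n → Carrier) (f : ℕ → Carrier) → (∀ j → g j ≈ f (toℕ j)) → sumFin R n g ≈ sum< n f
  sumFin≈sum< zero g f h = refl
  sumFin≈sum< (suc n) g f h = +-cong (h fzero) (sumFin≈sum< n (g ∘ fsuc) (f ∘ suc) (h ∘ fsuc))

  prod< : ℕ → (ℕ → Carrier) → Carrier
  prod< zero u = 1#
  prod< (suc t) u = prod< t u ⊗ u t

  sumFrom : (ℕ → Carrier) → ℕ → ℕ → Carrier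
  sumFrom f lo zero = 0#
  sumFrom f lo (suc k) = f lo ⊕ sumFrom f (suc lo) k

  prodFrom : (ℕ → Carrier) → ℕ → ℕ → Carrier
  prodFrom f lo zero = 1#
  prodFrom f lo (suc k) = f lo ⊗ prodFrom f (suc lo) k

  sumFrom-cong : ∀ k lo {f g : ℕ → Carrier} → (∀ {z} → lo ≤ z → f z ≈ g z) → sumFrom f lo k ≈ sumFrom g lo k
  sumFrom-cong zero lo h = refl
  sumFrom-cong (suc k) lo h = +-cong (h ≤-refl) (sumFrom-cong k (suc lo) (h ∘ ℕₚ.<⇒≤))

  sumFrom-zero : ∀ k lo {f : ℕ → Carrier} → (∀ {z} → lo ≤ z → f z ≈ 0#) → sumFrom f lo k ≈ 0#
  sumFrom-zero zero lo h = refl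
  sumFrom-zero (suc k) lo h = trans (+-cong (h ≤-refl) (sumFrom-zero k (suc lo) (h ∘ ℕₚ.<⇒≤))) (+-identityʳ 0#)

  sumFrom-+ : ∀ k lo (f g : ℕ → Carrier) → sumFrom (λ z → f z ⊕ g z) lo k ≈ sumFrom f lo k ⊕ sumFrom g lo k
  sumFrom-+ zero lo f g = sym (+-identityʳ 0#)
  sumFrom-+ (suc k) lo f g = trans (+-congˡ (sumFrom-+ k (suc lo) f g)) (interchange _ _ _ _)

  sumFrom-*ˡ : ∀ k lo a (f : ℕ → Carrier) → sumFrom (λ z → a ⊗ f z) lo k ≈ a ⊗ sumFrom f lo k
  sumFrom-*ˡ zero lo a f = sym (zeroʳ a)
  sumFrom-*ˡ (suc k) lo a f = trans (+-congˡ (sumFrom-*ˡ k (suc lo) a f)) (sym (distribˡ a _ _))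

  prodFrom-+ : ∀ k₁ k₂ lo (f : ℕ → Carrier) → prodFrom f lo (k₁ + k₂) ≈ prodFrom f lo k₁ ⊗ prodFrom f (lo + k₁) k₂
  prodFrom-+ zero k₂ lo f = trans (reflexive (≡.cong (λ m → prodFrom f m k₂) (≡.sym (ℕₚ.+-identityʳ lo)))) (sym (*-identityˡ _))
  prodFrom-+ (suc k₁) k₂ lo f = trans (*-congˡ (prodFrom-+ k₁ k₂ (suc lo) f))
    (trans (sym (*-assoc _ _ _)) (*-congˡ (reflexive (≡.cong (λ m → prodFrom f m k₂) (≡.sym (ℕₚ.+-suc lo k₁))))))

  prodFrom-snoc : ∀ k lo (f : ℕ → Carrier) → prodFrom f lo (suc k) ≈ f (lo + k) ⊗ prodFrom f lo k
  prodFrom-snoc k lo f = begin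
    prodFrom f lo (suc k)                        ≡⟨ ≡.cong (prodFrom f lo) (ℕₚ.+-comm 1 k) ⟩
    prodFrom f lo (k + 1)                        ≈⟨ prodFrom-+ k 1 lo f ⟩
    prodFrom f lo k ⊗ (f (lo + k) ⊗ 1#)          ≈⟨ trans (*-congˡ (*-identityʳ _)) (*-comm _ _) ⟩
    f (lo + k) ⊗ prodFrom f lo k                 ∎

  prodFrom-one : ∀ k lo (f : ℕ → Carrier) → (∀ {i} → lo ≤ i → i < lo + k → f i ≈ 1#) → prodFrom f lo k ≈ 1#
  prodFrom-one zero lo f h = refl
  prodFrom-one (suc k) lo f h = trans (*-cong (h ≤-refl (≡.subst (lo <_) (≡.sym (ℕₚ.+-suc lo k)) (s≤s (m≤m+n lo k))))
    (prodFrom-one k (suc lo) f (λ {i} lo<i i< → h (ℕₚ.<⇒≤ lo<i) (≡.subst (i <_) (≡.sym (ℕₚ.+-suc lo k)) i<)))) (*-identityˡ 1#)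

  sumL-++ : ∀ xs ys → sumL R (xs ++ ys) ≈ sumL R xs ⊕ sumL R ys
  sumL-++ [] ys = sym (+-identityˡ _)
  sumL-++ (x ∷ xs) ys = trans (+-congˡ (sumL-++ xs ys)) (sym (+-assoc _ _ _))

  sumL-map-cong : ∀ {A : Set} (xs : List A) {f g : A → Carrier} → (∀ z → f z ≈ g z) → sumL R (map f xs) ≈ sumL R (map g xs)
  sumL-map-cong [] h = refl
  sumL-map-cong (x ∷ xs) h = +-cong (h x) (sumL-map-cong xs h)

  sumL-concatMap : ∀ {A B : Set} (g : B → Carrier) (h : A → List B) xs →
    sumL R (map g (concatMap h xs)) ≈ sumL R (map (λ z → sumL R (map g (h z))) xs)
  sumL-concatMap g h [] = refl
  sumL-concatMap g h (x ∷ xs) = trans (reflexive (≡.cong (sumL R) (Listₚ.map-++ g (h x) (concatMap h xs))))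
    (trans (sumL-++ (map g (h x)) (map g (concatMap h xs))) (+-congˡ (sumL-concatMap g h xs)))

  prodL-countFrom : ∀ (f : ℕ → Carrier) lo k → prodL R (map f (countFrom lo k)) ≡ prodFrom f lo k
  prodL-countFrom f lo zero = ≡.refl
  prodL-countFrom f lo (suc k) = ≡.cong (f lo ⊗_) (prodL-countFrom f (suc lo) k)

  prod<-cong : ∀ n {u v : ℕ → Carrier} → (∀ {j} → j < n → u j ≈ v j) → prod< n u ≈ prod< n v
  prod<-cong zero h = refl
  prod<-cong (suc n) h = *-cong (prod<-cong n (h ∘ ℕₚ.m<n⇒m<1+n)) (h ≤-refl)

  prod<-one : ∀ n (u : ℕ → Carrier) → (∀ {j} → j < n → u j ≈ 1#) → prod< n u ≈ 1#
  prod<-one n u h = trans (prod<-cong n h) (ones n)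
    where
    ones : ∀ n → prod< n (λ _ → 1#) ≈ 1#
    ones zero = refl
    ones (suc n) = trans (*-identityʳ _) (ones n)

  prod<≈prodL-upTo : ∀ n (u : ℕ → Carrier) → prod< n u ≈ prodL R (map u (upTo n))
  prod<≈prodL-upTo zero u = refl
  prod<≈prodL-upTo (suc n) u = begin
    prod< n u ⊗ u n                                   ≈⟨ *-cong (prod<≈prodL-upTo n u) (sym (*-identityʳ _)) ⟩
    prodL R (map u (upTo n)) ⊗ prodL R (map u [ n ])   ≈⟨ prodL-++ (map u (upTo n)) (map u [ n ]) ⟨
    prodL R (map u (upTo n) ++ map u [ n ])            ≡⟨ ≡.cong (prodL R) (Listₚ.map-++ u (upTo n) [ n ]) ⟨
    prodL R (map u (upTo n ∷ʳ n))                      ≡⟨ ≡.cong (prodL R ∘ map u) (Listₚ.upTo-∷ʳ n) ⟩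
    prodL R (map u (upTo (suc n)))                     ∎
    where
    prodL-++ : ∀ xs ys → prodL R (xs ++ ys) ≈ prodL R xs ⊗ prodL R ys
    prodL-++ [] ys = sym (*-identityˡ _)
    prodL-++ (z ∷ xs) ys = trans (*-congˡ (prodL-++ xs ys)) (sym (*-assoc _ _ _))

module Determinant {c ℓ} (R : CommutativeRing c ℓ) where

  open CommutativeRing R hiding (zero) renaming (_+_ to _⊕_; _*_ to _⊗_)
  open import Algebra.Properties.Ring ring using (-‿distribˡ-*; -‿distribʳ-*; -‿involutive; -‿injective; -0#≈0#)
  open import Algebra.Properties.CommutativeSemigroup *-commutativeSemigroup using (x∙yz≈y∙xz)
  open import Relation.Binary.Reasoning.Setoid setoid
  open FiniteSums R

  Matrix : Set c
  Matrix = ℕ → ℕ → Carrier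

  sgn : ℕ → Carrier
  sgn = altSign R

  minor : ℕ → Matrix → Matrix
  minor j M i k = M (suc i) (punchInℕ j k)

  -- Defs.det on ℕ-indexed matrices, so that minors need no Fin arithmetic
  mutual
    detℕ : ℕ → Matrix → Carrier
    detℕ zero M = 1#
    detℕ (suc n) M = sum< (suc n) (laplaceTerm n M)

    laplaceTerm : ℕ → Matrix → ℕ → Carrier
    laplaceTerm n M j = sgn j ⊗ (M 0 j ⊗ detℕ n (minor j M))

  det≈detℕ : ∀ n (A : Fin n → Fin n → Carrier) (M : Matrix) → (∀ i j → A i j ≈ M (toℕ i) (toℕ j)) → det R n A ≈ detℕ n M
  det≈detℕ zero A M h = refl
  det≈detℕ (suc n) A M h = sumFin≈sum< (suc n) _ (laplaceTerm n M) λ j →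
    *-congˡ (*-cong (h fzero j) (det≈detℕ n _ (minor (toℕ j) M) λ i k →
      ≡.subst (λ z → A (fsuc i) (punchIn j k) ≈ M (suc (toℕ i)) z) (toℕ-punchIn j k) (h (fsuc i) (punchIn j k))))

  detℕ-cong : ∀ n {M N : Matrix} → (∀ {i k} → i < n → k < n → M i k ≈ N i k) → detℕ n M ≈ detℕ n N
  detℕ-cong zero h = refl
  detℕ-cong (suc n) {M} {N} h =
    sum<-cong (suc n) {laplaceTerm n M} {laplaceTerm n N} λ {j} j<n →
    *-congˡ (*-cong (h (s≤s z≤n) j<n) (detℕ-cong n λ {_} {k} i<n k<n → h (s≤s i<n) (punchInℕ-< j k k<n)))

  private
    pull-combination : ∀ s a b p q → s ⊗ (a ⊗ p ⊕ b ⊗ q) ≈ a ⊗ (s ⊗ p) ⊕ b ⊗ (s ⊗ q)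
    pull-combination s a b p q = trans (distribˡ s _ _) (+-cong (x∙yz≈y∙xz s a p) (x∙yz≈y∙xz s b q))

  detℕ-linear : ∀ n {q} → q < n → ∀ (a b : Carrier) (M M₁ M₂ : Matrix) →
    (∀ {i} → i < n → M i q ≈ a ⊗ M₁ i q ⊕ b ⊗ M₂ i q) →
    (∀ {i k} → i < n → k < n → k ≢ q → M i k ≈ M₁ i k × M i k ≈ M₂ i k) →
    detℕ n M ≈ a ⊗ detℕ n M₁ ⊕ b ⊗ detℕ n M₂
  detℕ-linear (suc n) {q} q<n a b M M₁ M₂ column-q others = begin
    detℕ (suc n) M                                           ≈⟨ sum<-cong (suc n) term ⟩
    sum< (suc n) (λ j → a ⊗ T₁ j ⊕ b ⊗ T₂ j)                 ≈⟨ sum<-+ (suc n) (λ j → a ⊗ T₁ j) (λ j → b ⊗ T₂ j) ⟩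
    sum< (suc n) (λ j → a ⊗ T₁ j) ⊕ sum< (suc n) (λ j → b ⊗ T₂ j) ≈⟨ +-cong (sum<-*ˡ (suc n) a T₁) (sum<-*ˡ (suc n) b T₂) ⟩
    a ⊗ detℕ (suc n) M₁ ⊕ b ⊗ detℕ (suc n) M₂                ∎
    where
    T₁ T₂ : ℕ → Carrier
    T₁ = laplaceTerm n M₁
    T₂ = laplaceTerm n M₂
    term : ∀ {j} → j < suc n → laplaceTerm n M j ≈ a ⊗ T₁ j ⊕ b ⊗ T₂ j
    term {j} j<n with j ≟ q
    ... | yes ≡.refl = begin
      sgn j ⊗ (M 0 j ⊗ D)                                      ≈⟨ *-congˡ (*-congʳ (column-q (s≤s z≤n))) ⟩
      sgn j ⊗ ((a ⊗ M₁ 0 j ⊕ b ⊗ M₂ 0 j) ⊗ D)                  ≈⟨ *-congˡ (trans (distribʳ D _ _) (+-cong (*-assoc a _ D) (*-assoc b _ D))) ⟩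
      sgn j ⊗ (a ⊗ (M₁ 0 j ⊗ D) ⊕ b ⊗ (M₂ 0 j ⊗ D))            ≈⟨ pull-combination _ a b _ _ ⟩
      a ⊗ (sgn j ⊗ (M₁ 0 j ⊗ D)) ⊕ b ⊗ (sgn j ⊗ (M₂ 0 j ⊗ D))  ≈⟨ +-cong (*-congˡ (*-congˡ (*-congˡ minor₁)))
                                                                          (*-congˡ (*-congˡ (*-congˡ minor₂))) ⟩
      a ⊗ T₁ j ⊕ b ⊗ T₂ j                                      ∎
      where
      D : Carrier
      D = detℕ n (minor j M)
      minor₁ : D ≈ detℕ n (minor j M₁)
      minor₁ = detℕ-cong n λ {_} {k} i<n k<n → proj₁ (others (s≤s i<n) (punchInℕ-< j k k<n) (punchInℕᵢ≢i j k))
      minor₂ : D ≈ detℕ n (minor j M₂)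
      minor₂ = detℕ-cong n λ {_} {k} i<n k<n → proj₂ (others (s≤s i<n) (punchInℕ-< j k k<n) (punchInℕᵢ≢i j k))
    ... | no j≢q = begin
      sgn j ⊗ (M 0 j ⊗ detℕ n (minor j M))                                       ≈⟨ *-congˡ (*-congˡ minor-linear) ⟩
      sgn j ⊗ (M 0 j ⊗ (a ⊗ detℕ n (minor j M₁) ⊕ b ⊗ detℕ n (minor j M₂)))       ≈⟨ *-congˡ (pull-combination _ a b _ _) ⟩
      sgn j ⊗ (a ⊗ (M 0 j ⊗ detℕ n (minor j M₁)) ⊕ b ⊗ (M 0 j ⊗ detℕ n (minor j M₂))) ≈⟨ pull-combination _ a b _ _ ⟩
      a ⊗ (sgn j ⊗ (M 0 j ⊗ detℕ n (minor j M₁))) ⊕ b ⊗ (sgn j ⊗ (M 0 j ⊗ detℕ n (minor j M₂)))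
        ≈⟨ +-cong (*-congˡ (*-congˡ (*-congʳ (proj₁ (others (s≤s z≤n) j<n j≢q)))))
                  (*-congˡ (*-congˡ (*-congʳ (proj₂ (others (s≤s z≤n) j<n j≢q))))) ⟩
      a ⊗ T₁ j ⊕ b ⊗ T₂ j ∎
      where
      q≢j : q ≢ j
      q≢j = j≢q ∘ ≡.sym
      q′ : ℕ
      q′ = punchOutℕ j q
      minor-linear : detℕ n (minor j M) ≈ a ⊗ detℕ n (minor j M₁) ⊕ b ⊗ detℕ n (minor j M₂)
      minor-linear = detℕ-linear n (punchOutℕ-< j q q<n q≢j j<n) a b (minor j M) (minor j M₁) (minor j M₂)
        (λ {i} i<n → ≡.subst (λ z → M (suc i) z ≈ a ⊗ M₁ (suc i) z ⊕ b ⊗ M₂ (suc i) z)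
                             (≡.sym (punchInℕ-punchOutℕ j q q≢j)) (column-q (s≤s i<n)))
        (λ {i} {k} i<n k<n k≢q′ → others (s≤s i<n) (punchInℕ-< j k k<n)
           (λ e → k≢q′ (punchInℕ-injective j k q′ (≡.trans e (≡.sym (punchInℕ-punchOutℕ j q q≢j))))))

  detℕ-zeroColumn : ∀ n {q} → q < n → (M : Matrix) → (∀ {i} → i < n → M i q ≈ 0#) → detℕ n M ≈ 0#
  detℕ-zeroColumn n {q} q<n M zero-q = begin
    detℕ n M                              ≈⟨ detℕ-linear n q<n 0# 0# M M M column (λ _ _ _ → refl , refl) ⟩
    0# ⊗ detℕ n M ⊕ 0# ⊗ detℕ n M          ≈⟨ +-cong (zeroˡ _) (zeroˡ _) ⟩
    0# ⊕ 0#                               ≈⟨ +-identityʳ 0# ⟩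
    0#                                    ∎
    where
    column : ∀ {i} → i < n → M i q ≈ 0# ⊗ M i q ⊕ 0# ⊗ M i q
    column i<n = trans (zero-q i<n) (sym (trans (+-cong (zeroˡ _) (zeroˡ _)) (+-identityʳ 0#)))

  swapColumns : ℕ → Matrix → Matrix
  swapColumns k M i j = M i (swapℕ k j)

  detℕ-swapColumns : ∀ n {k} → suc k < n → (M : Matrix) → detℕ n (swapColumns k M) ≈ - detℕ n M
  detℕ-swapColumns (suc n) {k} k<n M = begin
    detℕ (suc n) (swapColumns k M)          ≈⟨ sum<-cong (suc n) term ⟩
    sum< (suc n) (λ j → - L (swapℕ k j))    ≈⟨ sum<-neg (suc n) (L ∘ swapℕ k) ⟩
    - sum< (suc n) (L ∘ swapℕ k)            ≈⟨ -‿cong (sum<-swapℕ (suc n) k L k<n) ⟩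
    - detℕ (suc n) M                        ∎
    where
    L : ℕ → Carrier
    L = laplaceTerm n M
    term : ∀ {j} → j < suc n → laplaceTerm n (swapColumns k M) j ≈ - L (swapℕ k j)
    term {j} j<n with j ≟ k | j ≟ suc k
    ... | yes ≡.refl | _ = begin
      sgn j ⊗ (M 0 (swapℕ j j) ⊗ detℕ n (minor j (swapColumns j M)))
        ≈⟨ *-congˡ (*-cong (reflexive (≡.cong (M 0) (swapℕ-left j)))
                           (detℕ-cong n λ {i} {m} _ _ → reflexive (≡.cong (M (suc i)) (swapℕ-punchInℕ-left j m)))) ⟩
      sgn j ⊗ (M 0 (suc j) ⊗ detℕ n (minor (suc j) M))   ≈⟨ -‿involutive _ ⟨
      - (- (sgn j ⊗ (M 0 (suc j) ⊗ detℕ n (minor (suc j) M))))   ≈⟨ -‿cong (-‿distribˡ-* _ _) ⟩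
      - L (suc j)                                          ≡⟨ ≡.cong (-_ ∘ L) (swapℕ-left j) ⟨
      - L (swapℕ j j)                                      ∎
    ... | no _ | yes ≡.refl = begin
      sgn (suc k) ⊗ (M 0 (swapℕ k (suc k)) ⊗ detℕ n (minor (suc k) (swapColumns k M)))
        ≈⟨ *-congˡ (*-cong (reflexive (≡.cong (M 0) (swapℕ-right k)))
                           (detℕ-cong n λ {i} {m} _ _ → reflexive (≡.cong (M (suc i)) (swapℕ-punchInℕ-right k m)))) ⟩
      (- sgn k) ⊗ (M 0 k ⊗ detℕ n (minor k M))   ≈⟨ -‿distribˡ-* _ _ ⟨
      - L k                                      ≡⟨ ≡.cong (-_ ∘ L) (swapℕ-right k) ⟨
      - L (swapℕ k (suc k))                      ∎
    ... | no j≢k | no j≢1+k = begin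
      sgn j ⊗ (M 0 (swapℕ k j) ⊗ detℕ n (minor j (swapColumns k M)))
        ≈⟨ *-congˡ (*-cong (reflexive (≡.cong (M 0) (swapℕ-other k j j≢k j≢1+k)))
                           (detℕ-cong n λ {i} {m} _ _ → reflexive (≡.cong (M (suc i)) (swapℕ-punchInℕ j k m j≢k j≢1+k)))) ⟩
      sgn j ⊗ (M 0 j ⊗ detℕ n (swapColumns (punchOutℕ j k) (minor j M)))
        ≈⟨ *-congˡ (*-congˡ (detℕ-swapColumns n (suc-punchOutℕ-< j k k<n j<n j≢k j≢1+k) (minor j M))) ⟩
      sgn j ⊗ (M 0 j ⊗ (- detℕ n (minor j M)))   ≈⟨ *-congˡ (-‿distribʳ-* _ _) ⟨
      sgn j ⊗ (- (M 0 j ⊗ detℕ n (minor j M)))   ≈⟨ -‿distribʳ-* _ _ ⟨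
      - L j                                      ≡⟨ ≡.cong (-_ ∘ L) (swapℕ-other k j j≢k j≢1+k) ⟨
      - L (swapℕ k j)                            ∎

  detℕ-equalAdjacentColumns : ∀ n {k} → suc k < n → (M : Matrix) → (∀ {i} → i < n → M i k ≈ M i (suc k)) → detℕ n M ≈ 0#
  detℕ-equalAdjacentColumns (suc n) {k} k<n M equal = sum<-cancellingPair (suc n) k L k<n pair others
    where
    L : ℕ → Carrier
    L = laplaceTerm n M
    minors-equal : detℕ n (minor k M) ≈ detℕ n (minor (suc k) M)
    minors-equal = detℕ-cong n λ {i} {m} i<n _ → entry i<n m
      where
      entry : ∀ {i} → i < n → ∀ m → M (suc i) (punchInℕ k m) ≈ M (suc i) (punchInℕ (suc k) m)
      entry {i} i<n m with m ≟ k
      ... | yes ≡.refl = begin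
        M (suc i) (punchInℕ m m)         ≡⟨ ≡.cong (M (suc i)) (punchInℕ-self m) ⟩
        M (suc i) (suc m)                ≈⟨ equal (s≤s i<n) ⟨
        M (suc i) m                      ≡⟨ ≡.cong (M (suc i)) (punchInℕ-suc-self m) ⟨
        M (suc i) (punchInℕ (suc m) m)   ∎
      ... | no m≢k = reflexive (≡.cong (M (suc i)) (punchInℕ-adjacent k m m≢k))
    pair : L k ⊕ L (suc k) ≈ 0#
    pair = begin
      sgn k ⊗ (M 0 k ⊗ detℕ n (minor k M)) ⊕ (- sgn k) ⊗ (M 0 (suc k) ⊗ detℕ n (minor (suc k) M))
        ≈⟨ +-congˡ (*-congˡ (*-cong (equal (s≤s z≤n)) minors-equal)) ⟨
      sgn k ⊗ (M 0 k ⊗ detℕ n (minor k M)) ⊕ (- sgn k) ⊗ (M 0 k ⊗ detℕ n (minor k M))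
        ≈⟨ +-congˡ (-‿distribˡ-* _ _) ⟨
      L k ⊕ - L k   ≈⟨ -‿inverseʳ _ ⟩
      0#            ∎
    others : ∀ {j} → j < suc n → j ≢ k → j ≢ suc k → L j ≈ 0#
    others {j} j<n j≢k j≢1+k = begin
      L j                        ≈⟨ *-congˡ (*-congˡ (detℕ-equalAdjacentColumns n (suc-punchOutℕ-< j k k<n j<n j≢k j≢1+k) (minor j M) equal′)) ⟩
      sgn j ⊗ (M 0 j ⊗ 0#)       ≈⟨ *-congˡ (zeroʳ _) ⟩
      sgn j ⊗ 0#                 ≈⟨ zeroʳ _ ⟩
      0#                         ∎
      where
      equal′ : ∀ {i} → i < n → minor j M i (punchOutℕ j k) ≈ minor j M i (suc (punchOutℕ j k))
      equal′ {i} i<n = begin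
        M (suc i) (punchInℕ j (punchOutℕ j k))         ≡⟨ ≡.cong (M (suc i)) (punchInℕ-punchOutℕ j k (j≢k ∘ ≡.sym)) ⟩
        M (suc i) k                                    ≈⟨ equal (s≤s i<n) ⟩
        M (suc i) (suc k)                              ≡⟨ ≡.cong (M (suc i)) (punchInℕ-suc-punchOutℕ j k j≢k j≢1+k) ⟨
        M (suc i) (punchInℕ j (suc (punchOutℕ j k)))   ∎

  detℕ-equalColumns : ∀ n {p q} → p < q → q < n → (M : Matrix) → (∀ {i} → i < n → M i p ≈ M i q) → detℕ n M ≈ 0#
  detℕ-equalColumns n {p} p<q q<n M equal with ℕₚ.m≤n⇒∃[o]m+o≡n p<q
  ... | d , ≡.refl = go d q<n M equal
    where
    -- move column p + 1 + d leftwards by adjacent swaps until it sits next to column p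
    go : ∀ d → suc p + d < n → (M : Matrix) → (∀ {i} → i < n → M i p ≈ M i (suc p + d)) → detℕ n M ≈ 0#
    go zero q<n M equal = detℕ-equalAdjacentColumns n (≡.subst (_< n) (ℕₚ.+-identityʳ (suc p)) q<n) M
      (λ i<n → trans (equal i<n) (reflexive (≡.cong (M _) (ℕₚ.+-identityʳ (suc p)))))
    go (suc d) q<n M equal = -‿injective (begin
      - detℕ n M                      ≈⟨ detℕ-swapColumns n (≡.subst (_< n) (ℕₚ.+-suc (suc p) d) q<n) M ⟨
      detℕ n (swapColumns k M)        ≈⟨ go d (<-trans (n<1+n k) (≡.subst (_< n) (ℕₚ.+-suc (suc p) d) q<n)) (swapColumns k M) equal′ ⟩
      0#                              ≈⟨ -0#≈0# ⟨
      - 0#                            ∎)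
      where
      k : ℕ
      k = suc p + d
      equal′ : ∀ {i} → i < n → M i (swapℕ k p) ≈ M i (swapℕ k k)
      equal′ {i} i<n = begin
        M i (swapℕ k p)       ≡⟨ ≡.cong (M i) (swapℕ-other k p (ℕₚ.<⇒≢ p<k) (ℕₚ.<⇒≢ (<-trans p<k (n<1+n k)))) ⟩
        M i p                 ≈⟨ equal i<n ⟩
        M i (suc p + suc d)   ≡⟨ ≡.cong (M i) (≡.trans (ℕₚ.+-suc (suc p) d) (≡.sym (swapℕ-left k))) ⟩
        M i (swapℕ k k)       ∎
        where
        p<k : p < k
        p<k = s≤s (m≤m+n p d)

  detℕ-unitriangular : ∀ n (K : Matrix) → (∀ {i j} → j < i → i < n → K i j ≈ 0#) → (∀ {i} → i < n → K i i ≈ 1#) → detℕ n K ≈ 1#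
  detℕ-unitriangular zero K _ _ = refl
  detℕ-unitriangular (suc n) K below diagonal = begin
    sgn 0 ⊗ (K 0 0 ⊗ detℕ n (minor 0 K)) ⊕ sum< n (laplaceTerm n K ∘ suc)
      ≈⟨ +-cong (*-congˡ (*-cong (diagonal (s≤s z≤n)) minor₀)) (sum<-zero n offDiagonal) ⟩
    1# ⊗ (1# ⊗ 1#) ⊕ 0#   ≈⟨ +-identityʳ _ ⟩
    1# ⊗ (1# ⊗ 1#)        ≈⟨ trans (*-identityˡ _) (*-identityˡ _) ⟩
    1#                    ∎
    where
    minor₀ : detℕ n (minor 0 K) ≈ 1#
    minor₀ = detℕ-unitriangular n (minor 0 K) (λ j<i i<n → below (s≤s j<i) (s≤s i<n)) (λ i<n → diagonal (s≤s i<n))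
    offDiagonal : ∀ {j} → j < n → laplaceTerm n K (suc j) ≈ 0#
    offDiagonal {j} j<n = begin
      laplaceTerm n K (suc j)         ≈⟨ *-congˡ (*-congˡ (detℕ-zeroColumn n (≤-<-trans z≤n j<n) (minor (suc j) K)
                                            (λ i<n → below (s≤s z≤n) (s≤s i<n)))) ⟩
      sgn (suc j) ⊗ (K 0 (suc j) ⊗ 0#)   ≈⟨ *-congˡ (zeroʳ _) ⟩
      sgn (suc j) ⊗ 0#                   ≈⟨ zeroʳ _ ⟩
      0#                                 ∎

  replaceColumn : Matrix → ℕ → (ℕ → Carrier) → Matrix
  replaceColumn A t w i k = if k ≡ᵇ t then w i else A i k

  replaceColumn-at : ∀ A t w i → replaceColumn A t w i t ≡ w i
  replaceColumn-at A t w i = if-true (≡ᵇ-true {t} ≡.refl)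

  replaceColumn-off : ∀ A t w i {k} → k ≢ t → replaceColumn A t w i k ≡ A i k
  replaceColumn-off A t w i k≢t = if-false (≡ᵇ-false k≢t)

  data ColumnSpan (n : ℕ) (K : Matrix) (l : ℕ) : (ℕ → Carrier) → Set (c ⊔ ℓ) where
    none : ∀ {w} → (∀ {i} → i < n → w i ≈ 0#) → ColumnSpan n K l w
    addColumn : ∀ {w w′} l′ (a : Carrier) → l ≤ l′ → l′ < n → ColumnSpan n K l w′ →
                (∀ {i} → i < n → w i ≈ a ⊗ K i l′ ⊕ w′ i) → ColumnSpan n K l w

  ColumnSpan-resp : ∀ {n K l w w′} → ColumnSpan n K l w → (∀ {i} → i < n → w′ i ≈ w i) → ColumnSpan n K l w′
  ColumnSpan-resp (none h) e = none (λ i<n → trans (e i<n) (h i<n))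
  ColumnSpan-resp (addColumn l′ a l≤l′ l′<n s h) e = addColumn l′ a l≤l′ l′<n s (λ i<n → trans (e i<n) (h i<n))

  ColumnSpan-+ : ∀ {n K l w₁ w₂ w} → ColumnSpan n K l w₁ → ColumnSpan n K l w₂ →
    (∀ {i} → i < n → w i ≈ w₁ i ⊕ w₂ i) → ColumnSpan n K l w
  ColumnSpan-+ (none h) s₂ e = ColumnSpan-resp s₂ (λ i<n → trans (e i<n) (trans (+-congʳ (h i<n)) (+-identityˡ _)))
  ColumnSpan-+ {w₂ = w₂} (addColumn {w′ = w′} l′ a l≤l′ l′<n s₁ h) s₂ e =
    addColumn {w′ = λ i → w′ i ⊕ w₂ i} l′ a l≤l′ l′<n (ColumnSpan-+ s₁ s₂ (λ _ → refl))
      (λ i<n → trans (e i<n) (trans (+-congʳ (h i<n)) (+-assoc _ _ _)))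

  ColumnSpan-scale : ∀ {n K l w} (b : Carrier) → ColumnSpan n K l w → ColumnSpan n K l (λ i → b ⊗ w i)
  ColumnSpan-scale b (none h) = none (λ i<n → trans (*-congˡ (h i<n)) (zeroʳ b))
  ColumnSpan-scale b (addColumn l′ a l≤l′ l′<n s h) =
    addColumn l′ (b ⊗ a) l≤l′ l′<n (ColumnSpan-scale b s)
      (λ i<n → trans (*-congˡ (h i<n)) (trans (distribˡ b _ _) (+-congʳ (sym (*-assoc b a _)))))

  ColumnSpan-weaken : ∀ {n K l w} → ColumnSpan n K (suc l) w → ColumnSpan n K l w
  ColumnSpan-weaken (none h) = none h
  ColumnSpan-weaken (addColumn l′ a l<l′ l′<n s h) = addColumn l′ a (ℕₚ.<⇒≤ l<l′) l′<n (ColumnSpan-weaken s) h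

  ColumnSpan-column : ∀ {n K l} → l < n → ColumnSpan n K l (λ i → K i l)
  ColumnSpan-column l<n =
    addColumn _ 1# ≤-refl l<n (none (λ _ → refl)) (λ _ → sym (trans (+-identityʳ _) (*-identityˡ _)))

  detℕ-replaceColumn-inSpan : ∀ n K {l w} → ColumnSpan n K l w → ∀ {t} → t < l → t < n → (A : Matrix) →
    (∀ {i l′} → i < n → l ≤ l′ → l′ < n → A i l′ ≈ K i l′) → detℕ n (replaceColumn A t w) ≈ 0#
  detℕ-replaceColumn-inSpan n K {w = w} (none h) {t} t<l t<n A agree =
    detℕ-zeroColumn n t<n (replaceColumn A t w) (λ {i} i<n → trans (reflexive (replaceColumn-at A t w i)) (h i<n))
  detℕ-replaceColumn-inSpan n K {w = w} (addColumn {w′ = w′} l′ a l≤l′ l′<n s h) {t} t<l t<n A agree = begin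
    detℕ n (replaceColumn A t w)
      ≈⟨ detℕ-linear n t<n a 1# (replaceColumn A t w) (replaceColumn A t Kₗ′) (replaceColumn A t w′) column-t others ⟩
    a ⊗ detℕ n (replaceColumn A t Kₗ′) ⊕ 1# ⊗ detℕ n (replaceColumn A t w′)
      ≈⟨ +-cong (*-congˡ repeated) (*-congˡ (detℕ-replaceColumn-inSpan n K s t<l t<n A agree)) ⟩
    a ⊗ 0# ⊕ 1# ⊗ 0#   ≈⟨ +-cong (zeroʳ a) (zeroʳ 1#) ⟩
    0# ⊕ 0#            ≈⟨ +-identityʳ 0# ⟩
    0#                 ∎
    where
    Kₗ′ : ℕ → Carrier
    Kₗ′ i = K i l′
    t<l′ : t < l′
    t<l′ = <-≤-trans t<l l≤l′
    column-t : ∀ {i} → i < n → replaceColumn A t w i t ≈ a ⊗ replaceColumn A t Kₗ′ i t ⊕ 1# ⊗ replaceColumn A t w′ i t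
    column-t {i} i<n rewrite replaceColumn-at A t w i | replaceColumn-at A t Kₗ′ i | replaceColumn-at A t w′ i =
      trans (h i<n) (+-congˡ (sym (*-identityˡ _)))
    others : ∀ {i k} → i < n → k < n → k ≢ t →
      replaceColumn A t w i k ≈ replaceColumn A t Kₗ′ i k × replaceColumn A t w i k ≈ replaceColumn A t w′ i k
    others {i} _ _ k≢t rewrite replaceColumn-off A t w i k≢t | replaceColumn-off A t Kₗ′ i k≢t | replaceColumn-off A t w′ i k≢t =
      refl , refl
    repeated : detℕ n (replaceColumn A t Kₗ′) ≈ 0#
    repeated = detℕ-equalColumns n t<l′ l′<n (replaceColumn A t Kₗ′) λ {i} i<n → begin
      replaceColumn A t Kₗ′ i t    ≡⟨ replaceColumn-at A t Kₗ′ i ⟩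
      K i l′                       ≈⟨ agree i<n l≤l′ l′<n ⟨
      A i l′                       ≡⟨ replaceColumn-off A t Kₗ′ i (ℕₚ.>⇒≢ t<l′) ⟨
      replaceColumn A t Kₗ′ i l′   ∎

  mixColumns : ℕ → Matrix → Matrix → Matrix
  mixColumns t M K i k = if k <ᵇ t then M i k else K i k

  detℕ-columnReduction : ∀ n (M K : Matrix) (u : ℕ → Carrier) →
    (∀ {j} → j < n → Σ (ℕ → Carrier) λ w → ColumnSpan n K (suc j) w × (∀ {i} → i < n → M i j ≈ u j ⊗ K i j ⊕ w i)) →
    detℕ n M ≈ prod< n u ⊗ detℕ n K
  detℕ-columnReduction n M K u reduce = begin
    detℕ n M                   ≈⟨ detℕ-cong n (λ _ k<n → reflexive (≡.sym (if-true (<ᵇ-true k<n)))) ⟩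
    detℕ n (mixColumns n M K)  ≈⟨ mixed n ≤-refl ⟩
    prod< n u ⊗ detℕ n K       ∎
    where
    mixed : ∀ t → t ≤ n → detℕ n (mixColumns t M K) ≈ prod< t u ⊗ detℕ n K
    mixed zero _ = sym (*-identityˡ _)
    mixed (suc t) t<n = begin
      detℕ n (mixColumns (suc t) M K)
        ≈⟨ detℕ-linear n t<n (u t) 1# _ (mixColumns t M K) (replaceColumn (mixColumns t M K) t w) column-t others ⟩
      u t ⊗ detℕ n (mixColumns t M K) ⊕ 1# ⊗ detℕ n (replaceColumn (mixColumns t M K) t w)
        ≈⟨ +-cong (*-congˡ (mixed t (ℕₚ.<⇒≤ t<n)))
                  (*-congˡ (detℕ-replaceColumn-inSpan n K w∈span (n<1+n t) t<n (mixColumns t M K)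
                     (λ _ t<l′ _ → reflexive (if-false (<ᵇ-false (ℕₚ.<⇒≤ t<l′)))))) ⟩
      u t ⊗ (prod< t u ⊗ detℕ n K) ⊕ 1# ⊗ 0#   ≈⟨ trans (+-congˡ (zeroʳ 1#)) (+-identityʳ _) ⟩
      u t ⊗ (prod< t u ⊗ detℕ n K)             ≈⟨ *-assoc _ _ _ ⟨
      (u t ⊗ prod< t u) ⊗ detℕ n K             ≈⟨ *-congʳ (*-comm _ _) ⟩
      prod< (suc t) u ⊗ detℕ n K               ∎
      where
      w : ℕ → Carrier
      w = proj₁ (reduce t<n)
      w∈span : ColumnSpan n K (suc t) w
      w∈span = proj₁ (proj₂ (reduce t<n))
      column-t : ∀ {i} → i < n →
        mixColumns (suc t) M K i t ≈ u t ⊗ mixColumns t M K i t ⊕ 1# ⊗ replaceColumn (mixColumns t M K) t w i t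
      column-t {i} i<n = begin
        mixColumns (suc t) M K i t                ≡⟨ if-true (<ᵇ-true (n<1+n t)) ⟩
        M i t                                     ≈⟨ proj₂ (proj₂ (reduce t<n)) i<n ⟩
        u t ⊗ K i t ⊕ w i                         ≈⟨ +-cong (*-congˡ (reflexive (≡.sym (if-false (<ᵇ-false (≤-refl {t}))))))
                                                             (sym (*-identityˡ _)) ⟩
        u t ⊗ mixColumns t M K i t ⊕ 1# ⊗ w i     ≡⟨ ≡.cong (λ z → u t ⊗ mixColumns t M K i t ⊕ 1# ⊗ z)
                                                             (≡.sym (replaceColumn-at (mixColumns t M K) t w i)) ⟩
        u t ⊗ mixColumns t M K i t ⊕ 1# ⊗ replaceColumn (mixColumns t M K) t w i t ∎
      unchanged : ∀ i {k} → k ≢ t → mixColumns (suc t) M K i k ≡ mixColumns t M K i k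
      unchanged i {k} k≢t with ℕₚ.<-cmp k t
      ... | tri< k<t _ _ = ≡.trans (if-true (<ᵇ-true (ℕₚ.m<n⇒m<1+n k<t))) (≡.sym (if-true (<ᵇ-true k<t)))
      ... | tri≈ _ k≡t _ = ⊥-elim (k≢t k≡t)
      ... | tri> _ _ t<k = ≡.trans (if-false (<ᵇ-false t<k)) (≡.sym (if-false (<ᵇ-false (ℕₚ.<⇒≤ t<k))))
      others : ∀ {i k} → i < n → k < n → k ≢ t →
        mixColumns (suc t) M K i k ≈ mixColumns t M K i k × mixColumns (suc t) M K i k ≈ replaceColumn (mixColumns t M K) t w i k
      others {i} _ _ k≢t = reflexive (unchanged i k≢t) ,
        reflexive (≡.trans (unchanged i k≢t) (≡.sym (replaceColumn-off (mixColumns t M K) t w i k≢t)))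

-- Partitions and the extended diagram

row-[] : ∀ i → row [] i ≡ 0
row-[] zero = ≡.refl
row-[] (suc i) = ≡.refl

row≤row₁ : ∀ l → Linked _≥_ l → ∀ i → row l i ≤ row l 1
row≤row₁ l l↓ zero = z≤n
row≤row₁ [] l↓ (suc i) = z≤n
row≤row₁ (r ∷ rs) l↓ (suc zero) = ≤-refl
row≤row₁ (r ∷ []) l↓ (suc (suc i)) = ≡.subst (_≤ r) (≡.sym (row-[] (suc i))) z≤n
row≤row₁ (r ∷ r′ ∷ rs) (r≥r′ ∷ l↓) (suc (suc i)) = ≤-trans (row≤row₁ (r′ ∷ rs) l↓ (suc i)) r≥r′

row-antitone : ∀ l → Linked _≥_ l → ∀ {i j} → 1 ≤ i → i ≤ j → row l j ≤ row l i
row-antitone l l↓ {suc zero} {j} _ _ = row≤row₁ l l↓ j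
row-antitone [] l↓ {suc (suc i)} {j} _ _ = ≡.subst (_≤ 0) (≡.sym (row-[] j)) z≤n
row-antitone (r ∷ []) l↓ {suc (suc i)} {suc zero} _ (s≤s ())
row-antitone (r ∷ []) l↓ {suc (suc i)} {suc (suc j)} _ _ = ≡.subst (_≤ row [] (suc i)) (≡.sym (row-[] (suc j))) z≤n
row-antitone (r ∷ r′ ∷ rs) (_ ∷ l↓) {suc (suc i)} {suc (suc j)} _ (s≤s i≤j) = row-antitone (r′ ∷ rs) l↓ (s≤s z≤n) i≤j

row-beyondLength : ∀ l {i} → length l < i → row l i ≡ 0
row-beyondLength [] {i} _ = row-[] i
row-beyondLength (r ∷ rs) {suc (suc i)} (s≤s p) = row-beyondLength rs p

columnLength : List ℕ → ℕ → ℕ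
columnLength [] c = 0
columnLength (r ∷ rs) c = if c ≤ᵇ r then suc (columnLength rs c) else 0

columnLength≤length : ∀ l c → columnLength l c ≤ length l
columnLength≤length [] c = z≤n
columnLength≤length (r ∷ rs) c with c ≤ᵇ r
... | true = s≤s (columnLength≤length rs c)
... | false = z≤n

columnLength-antitone : ∀ l {c c′} → c ≤ c′ → columnLength l c′ ≤ columnLength l c
columnLength-antitone [] c≤c′ = z≤n
columnLength-antitone (r ∷ rs) {c} {c′} c≤c′ with c′ ≤? r
... | yes c′≤r rewrite ≤ᵇ-true c′≤r | ≤ᵇ-true (≤-trans c≤c′ c′≤r) = s≤s (columnLength-antitone rs c≤c′)
... | no c′≰r rewrite ≤ᵇ-false (≰⇒> c′≰r) = z≤n

≤columnLength⇒≤row : ∀ l c {i} → 1 ≤ i → i ≤ columnLength l c → c ≤ row l i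
≤columnLength⇒≤row [] c {suc _} _ ()
≤columnLength⇒≤row (r ∷ rs) c {i} _ i≤ with c ≤? r
≤columnLength⇒≤row (r ∷ rs) c {suc zero} _ _ | yes c≤r = c≤r
≤columnLength⇒≤row (r ∷ rs) c {suc (suc i)} _ i≤ | yes c≤r rewrite ≤ᵇ-true c≤r =
  ≤columnLength⇒≤row rs c (s≤s z≤n) (≤-pred i≤)
≤columnLength⇒≤row (r ∷ rs) c {suc i} _ i≤ | no c≰r rewrite ≤ᵇ-false (≰⇒> c≰r) with i≤
... | ()

≤row⇒≤columnLength : ∀ l → Linked _≥_ l → ∀ c {i} → 1 ≤ i → i ≤ length l → c ≤ row l i → i ≤ columnLength l c
≤row⇒≤columnLength [] l↓ c {suc _} _ ()
≤row⇒≤columnLength (r ∷ rs) l↓ c {i} _ i≤N c≤λᵢ with c ≤? r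
≤row⇒≤columnLength (r ∷ rs) l↓ c {suc zero} _ _ _ | yes c≤r rewrite ≤ᵇ-true c≤r = s≤s z≤n
≤row⇒≤columnLength (r ∷ rs) l↓ c {suc (suc i)} _ i≤N c≤λᵢ | yes c≤r rewrite ≤ᵇ-true c≤r =
  s≤s (≤row⇒≤columnLength rs (Linked.tail l↓) c (s≤s z≤n) (≤-pred i≤N) c≤λᵢ)
≤row⇒≤columnLength (r ∷ rs) l↓ c {suc i} _ _ c≤λᵢ | no c≰r = ⊥-elim (c≰r (≤-trans c≤λᵢ (row≤row₁ (r ∷ rs) l↓ (suc i))))

row<-beyondColumnLength : ∀ l → Linked _≥_ l → ∀ c {i} → columnLength l (suc c) < i → row l i < suc c
row<-beyondColumnLength l l↓ c {i} beyond with suc c ≤? row l i | i ≤? length l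
... | no c≰λᵢ | _ = ≰⇒> c≰λᵢ
... | yes c<λᵢ | yes i≤N = ⊥-elim (ℕₚ.<⇒≱ beyond (≤row⇒≤columnLength l l↓ (suc c) (≤-trans (s≤s z≤n) beyond) i≤N c<λᵢ))
... | yes _ | no i≰N = ≡.subst (_< suc c) (≡.sym (row-beyondLength l (≰⇒> i≰N))) (s≤s z≤n)

inLam⁺ : ∀ l {i j} → 1 ≤ i → i ≤ length l → 1 ≤ j → j ≤ row l i → inLam l i j ≡ true
inLam⁺ l p q r s rewrite ≤ᵇ-true p | ≤ᵇ-true q | ≤ᵇ-true r | ≤ᵇ-true s = ≡.refl

inLam⁻ : ∀ l i j → inLam l i j ≡ true → 1 ≤ i × i ≤ length l × 1 ≤ j × j ≤ row l i
inLam⁻ l i j e with ∧≡true⇒ {1 ≤ᵇ i} e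
... | e₁ , e′ with ∧≡true⇒ {i ≤ᵇ length l} e′
... | e₂ , e″ with ∧≡true⇒ {1 ≤ᵇ j} e″
... | e₃ , e₄ = ≤ᵇ-true⁻ e₁ , ≤ᵇ-true⁻ e₂ , ≤ᵇ-true⁻ e₃ , ≤ᵇ-true⁻ e₄

inStar⁺ : ∀ l {i j} → 1 ≤ i → i ≤ suc (length l) → 1 ≤ j → j ≤ rowStar l i → inStar l i j ≡ true
inStar⁺ l p q r s rewrite ≤ᵇ-true p | ≤ᵇ-true q | ≤ᵇ-true r | ≤ᵇ-true s = ≡.refl

inStar⁻ : ∀ l i j → inStar l i j ≡ true → 1 ≤ i × i ≤ suc (length l) × 1 ≤ j × j ≤ rowStar l i
inStar⁻ l i j e with ∧≡true⇒ {1 ≤ᵇ i} e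
... | e₁ , e′ with ∧≡true⇒ {i ≤ᵇ suc (length l)} e′
... | e₂ , e″ with ∧≡true⇒ {1 ≤ᵇ j} e″
... | e₃ , e₄ = ≤ᵇ-true⁻ e₁ , ≤ᵇ-true⁻ e₂ , ≤ᵇ-true⁻ e₃ , ≤ᵇ-true⁻ e₄

rowStar-suc : ∀ l {r} → 1 ≤ r → r ≤ length l → rowStar l (suc r) ≡ suc (row l r)
rowStar-suc l {suc r} _ r≤N = if-true (≤ᵇ-true (s≤s r≤N))

fromTo-sideOfSquare : ∀ a k → fromTo a (a + suc k ∸ 1) ≡ countFrom a (suc k)
fromTo-sideOfSquare a k = ≡.trans (fromTo≡countFrom a (a + suc k ∸ 1)) (≡.cong (countFrom a) count)
  where
  count : suc (a + suc k ∸ 1) ∸ a ≡ suc k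
  count rewrite ℕₚ.+-suc a k = ≡.trans (ℕₚ.+-∸-assoc 1 (m≤m+n a k)) (≡.cong suc (ℕₚ.m+n∸m≡n a k))

squareIn⁻ : ∀ l a b n → squareIn l a b n ≡ true → ∀ {i j} → i < n → j < n → inStar l (a + i) (b + j) ≡ true
squareIn⁻ l a b (suc k) sq i<n j<n rewrite fromTo-sideOfSquare a k | fromTo-sideOfSquare b k =
  all-countFrom⁻ (λ j′ → inStar l (a + _) j′) (all-countFrom⁻ (λ i′ → all (inStar l i′) (countFrom b (suc k))) sq i<n) j<n

squareIn⁺ : ∀ l a b k → (∀ {i j} → i < suc k → j < suc k → inStar l (a + i) (b + j) ≡ true) → squareIn l a b (suc k) ≡ true
squareIn⁺ l a b k cells rewrite fromTo-sideOfSquare a k | fromTo-sideOfSquare b k =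
  all-countFrom⁺ _ a (suc k) (λ i<n → all-countFrom⁺ _ b (suc k) (λ j<n → cells i<n j<n))

IsLargestSquare : List ℕ → ℕ → ℕ → ℕ → ℕ → Set
IsLargestSquare l a b k n = 1 ≤ n × squareIn l a b n ≡ true × (∀ {m} → n < m → m ≤ k → squareIn l a b m ≡ false)

largestSq-spec : ∀ l a b k → squareIn l a b 1 ≡ true → 1 ≤ k → IsLargestSquare l a b k (largestSq l a b k)
largestSq-spec l a b (suc zero) sq₁ _ rewrite sq₁ = s≤s z≤n , sq₁ , λ p q → ⊥-elim (ℕₚ.<⇒≱ p q)
largestSq-spec l a b (suc (suc k)) sq₁ _ = extend (largestSq-spec l a b (suc k) sq₁ (s≤s z≤n))
  where
  extend : IsLargestSquare l a b (suc k) (largestSq l a b (suc k)) →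
           IsLargestSquare l a b (suc (suc k)) (largestSq l a b (suc (suc k)))
  extend (1≤n , sq , maximal) with squareIn l a b (suc (suc k)) in e
  ... | true = s≤s z≤n , e , λ p q → ⊥-elim (ℕₚ.<⇒≱ p q)
  ... | false = 1≤n , sq , beyond
    where
    beyond : ∀ {m} → largestSq l a b (suc k) < m → m ≤ suc (suc k) → squareIn l a b m ≡ false
    beyond {m} n<m m≤k with m ≟ suc (suc k)
    ... | yes ≡.refl = e
    ... | no m≢k = maximal n<m (≤-pred (ℕₚ.≤∧≢⇒< m≤k m≢k))

rowStar-lowerBound : ∀ l → Linked _≥_ l → ∀ {r s} → r ≤ s → s ≤ length l → suc (row l s) ≤ rowStar l (suc r)
rowStar-lowerBound l l↓ {zero} {s} _ _ = s≤s (row≤row₁ l l↓ s)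
rowStar-lowerBound l l↓ {suc r} {s} r≤s s≤N =
  ≡.subst (suc (row l s) ≤_) (≡.sym (rowStar-suc l (s≤s z≤n) (≤-trans r≤s s≤N))) (s≤s (row-antitone l l↓ (s≤s z≤n) r≤s))

inStar⇒pred≤columnLength : ∀ l → Linked _≥_ l → ∀ {a γ} → inStar l a (suc γ) ≡ true → a ∸ 1 ≤ columnLength l γ
inStar⇒pred≤columnLength l l↓ {a} {γ} a,γ+1∈λ* with inStar⁻ l a (suc γ) a,γ+1∈λ* | a ∸ 1 ≟ 0
... | _ | yes a′≡0 = ≡.subst (_≤ columnLength l γ) (≡.sym a′≡0) z≤n
... | 1≤a , a≤N+1 , _ , γ<λ*ₐ | no a′≢0 =
  ≤row⇒≤columnLength l l↓ γ 1≤a′ a′≤N (≤-pred (≡.subst (suc γ ≤_) (rowStar-suc l 1≤a′ a′≤N) (≡.subst (λ r → suc γ ≤ rowStar l r) (≡.sym 1+a′≡a) γ<λ*ₐ)))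
  where
  1+a′≡a : suc (a ∸ 1) ≡ a
  1+a′≡a = ℕₚ.m+[n∸m]≡n 1≤a
  1≤a′ : 1 ≤ a ∸ 1
  1≤a′ = ℕₚ.n≢0⇒n>0 a′≢0
  a′≤N : a ∸ 1 ≤ length l
  a′≤N = ≤-pred (≡.subst (_≤ suc (length l)) (≡.sym 1+a′≡a) a≤N+1)

¬inLam⇒row≤ : ∀ l {a γ} → 1 ≤ a → inLam l a (suc γ) ≡ false → row l a ≤ γ
¬inLam⇒row≤ l {a} {γ} 1≤a a,γ+1∉λ with a ≤? length l | suc γ ≤? row l a
... | no a≰N | _ = ≡.subst (_≤ γ) (≡.sym (row-beyondLength l (≰⇒> a≰N))) z≤n
... | yes _ | no γ≮λₐ = ≤-pred (≰⇒> γ≮λₐ)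
... | yes a≤N | yes γ<λₐ with () ← ≡.trans (≡.sym (inLam⁺ l 1≤a a≤N (s≤s z≤n) γ<λₐ)) a,γ+1∉λ

module LargestSquare (l : List ℕ) (l↓ : Linked _≥_ l) (α β : ℕ) (corner : inStar l (suc α) (suc β) ≡ true) where

  n : ℕ
  n = nab l (suc α) (suc β)

  private
    square₁ : squareIn l (suc α) (suc β) 1 ≡ true
    square₁ = squareIn⁺ l (suc α) (suc β) 0 λ where
      (s≤s z≤n) (s≤s z≤n) → ≡.subst₂ (λ u v → inStar l u v ≡ true) (≡.sym (ℕₚ.+-identityʳ (suc α))) (≡.sym (ℕₚ.+-identityʳ (suc β))) corner

    spec : IsLargestSquare l (suc α) (suc β) (suc (length l)) n
    spec = largestSq-spec l (suc α) (suc β) (suc (length l)) square₁ (s≤s z≤n)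

  1≤n : 1 ≤ n
  1≤n = proj₁ spec

  square-inStar : ∀ {i j} → i < n → j < n → inStar l (suc α + i) (suc β + j) ≡ true
  square-inStar = squareIn⁻ l (suc α) (suc β) n (proj₁ (proj₂ spec))

  private
    rowStar-bound : ∀ {i j} → i < n → j < n → 1 ≤ α + i → suc β + j ≤ suc (row l (α + i)) × α + i ≤ length l
    rowStar-bound {i} {j} i<n j<n 1≤ with inStar⁻ l (suc α + i) (suc β + j) (square-inStar i<n j<n)
    ... | _ , i≤N , _ , j≤ = ≡.subst (suc β + j ≤_) (rowStar-suc l 1≤ (≤-pred i≤N)) j≤ , ≤-pred i≤N

  diagonal≤columnLength : ∀ {j} → j < n → α + j ≤ columnLength l (β + j)
  diagonal≤columnLength {j} j<n with α + j ≟ 0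
  ... | yes α+j≡0 = ≡.subst (_≤ columnLength l (β + j)) (≡.sym α+j≡0) z≤n
  ... | no α+j≢0 = ≤row⇒≤columnLength l l↓ (β + j) 1≤ (proj₂ bound) (≤-pred (proj₁ bound))
    where
    1≤ : 1 ≤ α + j
    1≤ = ℕₚ.n≢0⇒n>0 α+j≢0
    bound = rowStar-bound j<n j<n 1≤

  -- λ*-row i+1 has length λᵢ + 1, so the λ-rows alongside the square are α, …, α+n-1.
  rowsOfSquare-long : ∀ {d} → 1 ≤ d → d < α + n → β + n ≤ suc (row l d)
  rowsOfSquare-long {d} 1≤d d<α+n =
    ≡.subst (_≤ suc (row l d)) β+n≡ (≤-trans (proj₁ bound) (s≤s (row-antitone l l↓ 1≤d d≤α+m)))
    where
    m : ℕ
    m = n ∸ 1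
    1+m≡n : suc m ≡ n
    1+m≡n = ℕₚ.m+[n∸m]≡n 1≤n
    d≤α+m : d ≤ α + m
    d≤α+m = ≤-pred (≡.subst (d <_) (≡.trans (≡.cong (α +_) (≡.sym 1+m≡n)) (ℕₚ.+-suc α m)) d<α+n)
    bound = rowStar-bound (ℕₚ.≤-reflexive 1+m≡n) (ℕₚ.≤-reflexive 1+m≡n) (≤-trans 1≤d d≤α+m)
    β+n≡ : suc β + m ≡ β + n
    β+n≡ = ≡.trans (≡.sym (ℕₚ.+-suc β m)) (≡.cong (β +_) 1+m≡n)

  rowBelowSquare-short : row l (α + n) < β + n
  rowBelowSquare-short with β + n ≤? row l (α + n)
  ... | no ≰ = ≰⇒> ≰
  ... | yes long = contradiction (≡.trans (≡.sym bigger) (proj₂ (proj₂ spec) (n<1+n n) (s≤s n≤N)))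
    where
    contradiction : true ≡ false → _
    contradiction ()
    α+n≤N : α + n ≤ length l
    α+n≤N with α + n ≤? length l
    ... | yes p = p
    ... | no p = ⊥-elim (ℕₚ.<⇒≱ (≤-trans 1≤n (m≤n+m n β)) (≤-trans long (ℕₚ.≤-reflexive (row-beyondLength l (≰⇒> p)))))
    n≤N : n ≤ length l
    n≤N = ≤-trans (m≤n+m n α) α+n≤N
    bigger : squareIn l (suc α) (suc β) (suc n) ≡ true
    bigger = squareIn⁺ l (suc α) (suc β) n λ {i} {j} i≤n j≤n →
      let α+i≤α+n = ℕₚ.+-monoʳ-≤ α (≤-pred i≤n) in
      inStar⁺ l (s≤s z≤n) (s≤s (≤-trans α+i≤α+n α+n≤N)) (s≤s z≤n)
        (≤-trans (s≤s (ℕₚ.+-monoʳ-≤ β (≤-pred j≤n))) (≤-trans (s≤s long) (rowStar-lowerBound l l↓ α+i≤α+n α+n≤N)))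

-- Boxes and sub-diagrams

Box : Set
Box = ℕ × ℕ

eqBox-refl : ∀ q → eqBox q q ≡ true
eqBox-refl (i , j) = ≡.cong₂ _∧_ (≡ᵇ-true {i} ≡.refl) (≡ᵇ-true {j} ≡.refl)

eqBox-≢row : ∀ {i j} p → i ≢ proj₁ p → eqBox (i , j) p ≡ false
eqBox-≢row {i} {j} p i≢ = ≡.cong (_∧ (j ≡ᵇ proj₂ p)) (≡ᵇ-false i≢)

eqBox-≢column : ∀ {i j} p → j ≢ proj₂ p → eqBox (i , j) p ≡ false
eqBox-≢column {i} {j} p j≢ = ≡.trans (≡.cong ((i ≡ᵇ proj₁ p) ∧_) (≡ᵇ-false j≢)) (∧-zeroʳ _)

memBox-otherRows : ∀ {r s} ν → All (λ p → proj₁ p ≢ r) ν → memBox (r , s) ν ≡ false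
memBox-otherRows {r} {s} ν h = any-false (All.map (λ {p} ≢r → eqBox-≢row {r} {s} p (≢r ∘ ≡.sym)) h)

memBox-otherColumns : ∀ {r s} ν → All (λ p → proj₂ p ≢ s) ν → memBox (r , s) ν ≡ false
memBox-otherColumns {r} {s} ν h = any-false (All.map (λ {p} ≢s → eqBox-≢column {r} {s} p (≢s ∘ ≡.sym)) h)

rowBoxes : ℕ → ℕ → ℕ → List Box
rowBoxes a lo hi = map (a ,_) (fromTo lo hi)

rowBoxes-step : ∀ a {lo hi} → lo ≤ hi → rowBoxes a lo hi ≡ (a , lo) ∷ rowBoxes a (suc lo) hi
rowBoxes-step a lo≤hi = ≡.cong (map (a ,_)) (fromTo-step lo≤hi)

rowBoxes-empty : ∀ a {lo hi} → hi < lo → rowBoxes a lo hi ≡ []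
rowBoxes-empty a hi<lo = ≡.cong (map (a ,_)) (fromTo-empty hi<lo)

All-rowBoxes : ∀ a lo hi → All (λ p → proj₁ p ≡ a × lo ≤ proj₂ p × proj₂ p ≤ hi) (rowBoxes a lo hi)
All-rowBoxes a lo hi = Allₚ.map⁺ (All.map (λ (lo≤ , ≤hi) → ≡.refl , lo≤ , ≤hi) (All-fromTo lo hi))

memBox-rowBoxes : ∀ a {lo s} hi → lo ≤ s → memBox (a , s) (rowBoxes a lo hi) ≡ (s ≤ᵇ hi)
memBox-rowBoxes a {lo} hi lo≤s with ℕₚ.m≤n⇒∃[o]m+o≡n lo≤s
... | d , ≡.refl = go d lo
  where
  go : ∀ d lo → memBox (a , lo + d) (rowBoxes a lo hi) ≡ (lo + d ≤ᵇ hi)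
  go d lo with lo ≤? hi
  go zero lo | yes lo≤hi rewrite rowBoxes-step a lo≤hi | ℕₚ.+-identityʳ lo | eqBox-refl (a , lo) = ≡.sym (≤ᵇ-true lo≤hi)
  go (suc d) lo | yes lo≤hi rewrite rowBoxes-step a lo≤hi
                                  | eqBox-≢column {a} {lo + suc d} (a , lo) (ℕₚ.>⇒≢ (ℕₚ.m<m+n lo (s≤s z≤n)))
                                  | ℕₚ.+-suc lo d = go d (suc lo)
  go d lo | no lo≰hi rewrite rowBoxes-empty a (≰⇒> lo≰hi) = ≡.sym (≤ᵇ-false (<-≤-trans (≰⇒> lo≰hi) (m≤m+n lo d)))

boxesSE : List ℕ → ℕ → ℕ → List Box
boxesSE l a c = concatMap (λ i → rowBoxes i c (row l i)) (fromTo a (length l))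

lamSE≡boxesSE : ∀ l {a c} → 1 ≤ a → 1 ≤ c → lamSE l a c ≡ boxesSE l a c
lamSE≡boxesSE l {a} {c} 1≤a 1≤c = begin
  filterᵇ southEast (concatMap (λ i → map (i ,_) (fromTo 1 (row l i))) (fromTo 1 (length l)))
    ≡⟨ filterᵇ-concatMap southEast _ (fromTo 1 (length l)) ⟩
  concatMap (λ i → filterᵇ southEast (map (i ,_) (fromTo 1 (row l i)))) (fromTo 1 (length l))
    ≡⟨ Listₚ.concatMap-cong rowPart (fromTo 1 (length l)) ⟩
  concatMap (λ i → if a ≤ᵇ i then rowBoxes i c (row l i) else []) (fromTo 1 (length l))
    ≡⟨ concatMap-if (fromTo 1 (length l)) ⟩
  concatMap (λ i → rowBoxes i c (row l i)) (filterᵇ (a ≤ᵇ_) (fromTo 1 (length l)))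
    ≡⟨ ≡.cong (concatMap (λ i → rowBoxes i c (row l i))) (filterᵇ-fromTo (length l) 1≤a) ⟩
  boxesSE l a c ∎
  where
  open ≡.≡-Reasoning
  southEast : Box → Bool
  southEast (i , j) = (a ≤ᵇ i) ∧ (c ≤ᵇ j)
  rowPart : ∀ i → filterᵇ southEast (map (i ,_) (fromTo 1 (row l i))) ≡ (if a ≤ᵇ i then rowBoxes i c (row l i) else [])
  rowPart i rewrite filterᵇ-map southEast (i ,_) (fromTo 1 (row l i)) with a ≤ᵇ i
  ... | true = ≡.cong (map (i ,_)) (filterᵇ-fromTo (row l i) 1≤c)
  ... | false = ≡.cong (map (i ,_)) (Listₚ.filter-none (T? ∘ (λ _ → false)) {fromTo 1 (row l i)} (All.universal (λ _ ()) _))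
  concatMap-if : ∀ xs → concatMap (λ i → if a ≤ᵇ i then rowBoxes i c (row l i) else []) xs
                      ≡ concatMap (λ i → rowBoxes i c (row l i)) (filterᵇ (a ≤ᵇ_) xs)
  concatMap-if [] = ≡.refl
  concatMap-if (i ∷ is) with a ≤ᵇ i
  ... | true = ≡.cong (rowBoxes i c (row l i) ++_) (concatMap-if is)
  ... | false = concatMap-if is

boxesSE-step : ∀ l {a} c → a ≤ length l → boxesSE l a c ≡ rowBoxes a c (row l a) ++ boxesSE l (suc a) c
boxesSE-step l c a≤N = ≡.cong (concatMap (λ i → rowBoxes i c (row l i))) (fromTo-step a≤N)

boxesSE-empty : ∀ l a c → (∀ {i} → a ≤ i → row l i < c) → boxesSE l a c ≡ []
boxesSE-empty l a c short = empty (All-fromTo a (length l))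
  where
  empty : ∀ {is} → All (λ i → a ≤ i × i ≤ length l) is → concatMap (λ i → rowBoxes i c (row l i)) is ≡ []
  empty [] = ≡.refl
  empty {i ∷ _} ((a≤i , _) ∷ rest) rewrite rowBoxes-empty i (short a≤i) = empty rest

All-boxesSE : ∀ l a c → All (λ p → a ≤ proj₁ p × c ≤ proj₂ p × proj₂ p ≤ row l (proj₁ p)) (boxesSE l a c)
All-boxesSE l a c = Allₚ.concat⁺ (Allₚ.map⁺ (All.map inRow (All-fromTo a (length l))))
  where
  inRow : ∀ {i} → a ≤ i × i ≤ length l → All (λ p → a ≤ proj₁ p × c ≤ proj₂ p × proj₂ p ≤ row l (proj₁ p)) (rowBoxes i c (row l i))
  inRow (a≤i , _) = All.map (λ { (≡.refl , c≤ , ≤λ) → a≤i , c≤ , ≤λ }) (All-rowBoxes _ c _)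

rowFilledTo : ℕ → ℕ → List Box → ℕ → Bool
rowFilledTo a c S s = all (λ s′ → memBox (a , s′) S) (fromTo c s)

rowClosed : ℕ → ℕ → List Box → Bool
rowClosed a c S = all (λ p → rowFilledTo a c S (proj₂ p)) S

columnsWithin : ℕ → List Box → Bool
columnsWithin u μ = all (λ p → proj₂ p ≤ᵇ u) μ

boundedSubdiagram : ℕ → ℕ → ℕ → List Box → Bool
boundedSubdiagram a c u μ = columnsWithin u μ ∧ isSubdiagram a c μ

-- what remains of boundedSubdiagram a c u (S ++ μ), for S in row a, once S is known to be rowClosed
compatibleBelow : ℕ → ℕ → ℕ → List Box → List Box → Bool
compatibleBelow a c u S μ =
  (columnsWithin u S ∧ columnsWithin u μ) ∧ (all (λ p → rowFilledTo a c S (proj₂ p)) μ ∧ isSubdiagram (suc a) c μ)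

isSubdiagram-++ : ∀ a c S μ → All (λ p → proj₁ p ≡ a) S → All (λ p → suc a ≤ proj₁ p) μ →
  isSubdiagram a c (S ++ μ) ≡ rowClosed a c S ∧ (all (λ p → rowFilledTo a c S (proj₂ p)) μ ∧ isSubdiagram (suc a) c μ)
isSubdiagram-++ a c S μ S-in-a μ-below = ≡.trans (all-++ (closedAt a ν) S μ) (≡.cong₂ _∧_ S-part μ-part)
  where
  ν : List Box
  ν = S ++ μ
  closedAt : ℕ → List Box → Box → Bool
  closedAt a′ ν p = all (λ r′ → all (λ s′ → memBox (r′ , s′) ν) (fromTo c (proj₂ p))) (fromTo a′ (proj₁ p))
  row-a : ∀ s → all (λ s′ → memBox (a , s′) ν) (fromTo c s) ≡ rowFilledTo a c S s
  row-a s = all-cong (fromTo c s) λ s′ → ≡.trans (any-++ (eqBox (a , s′)) S μ)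
    (≡.trans (≡.cong (memBox (a , s′) S ∨_) (memBox-otherRows {a} {s′} μ (All.map (λ a<r e → <-irrefl (≡.sym e) a<r) μ-below))) (∨-identityʳ _))
  lower-row : ∀ {r′} → suc a ≤ r′ → ∀ s′ → memBox (r′ , s′) ν ≡ memBox (r′ , s′) μ
  lower-row {r′} a<r′ s′ = ≡.trans (any-++ (eqBox (r′ , s′)) S μ)
    (≡.cong (_∨ memBox (r′ , s′) μ) (memBox-otherRows {r′} {s′} S (All.map (λ { ≡.refl e → <-irrefl e a<r′ }) S-in-a)))
  S-part : all (closedAt a ν) S ≡ rowClosed a c S
  S-part = all-congᴬ S-in-a λ {p} p-in-a →
    ≡.trans (≡.cong (λ r → all (λ r′ → all (λ s′ → memBox (r′ , s′) ν) (fromTo c (proj₂ p))) (fromTo a r)) p-in-a)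
    (≡.trans (≡.cong (all (λ r′ → all (λ s′ → memBox (r′ , s′) ν) (fromTo c (proj₂ p)))) (fromTo-single a))
    (≡.trans (∧-identityʳ _) (row-a (proj₂ p))))
  μ-part : all (closedAt a ν) μ ≡ all (λ p → rowFilledTo a c S (proj₂ p)) μ ∧ isSubdiagram (suc a) c μ
  μ-part = ≡.trans (all-congᴬ μ-below λ {p} a<r →
      ≡.trans (≡.cong (all (λ r′ → all (λ s′ → memBox (r′ , s′) ν) (fromTo c (proj₂ p)))) (fromTo-step (ℕₚ.<⇒≤ a<r)))
      (≡.cong₂ _∧_ (row-a (proj₂ p))
        (all-congᴬ (All-fromTo (suc a) (proj₁ p)) λ (a<r′ , _) → all-cong (fromTo c (proj₂ p)) (lower-row a<r′))))
    (all-∧ (λ p → rowFilledTo a c S (proj₂ p)) (closedAt (suc a) μ) μ)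

rowClosed-∷ : ∀ a c S → All (λ p → proj₁ p ≡ a × suc c ≤ proj₂ p) S → rowClosed a c ((a , c) ∷ S) ≡ rowClosed a (suc c) S
rowClosed-∷ a c S S-right = ≡.cong₂ _∧_ first rest
  where
  T′ : List Box
  T′ = (a , c) ∷ S
  c∈T′ : memBox (a , c) T′ ≡ true
  c∈T′ = ≡.cong (_∨ memBox (a , c) S) (eqBox-refl (a , c))
  first : rowFilledTo a c T′ c ≡ true
  first = ≡.trans (≡.cong (all (λ s′ → memBox (a , s′) T′)) (fromTo-single c)) (≡.trans (∧-identityʳ _) c∈T′)
  rest : all (λ p → rowFilledTo a c T′ (proj₂ p)) S ≡ rowClosed a (suc c) S
  rest = all-congᴬ S-right λ {p} (_ , c<s) →
    ≡.trans (≡.cong (all (λ s′ → memBox (a , s′) T′)) (fromTo-step (ℕₚ.<⇒≤ c<s)))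
    (≡.trans (≡.cong (_∧ all (λ s′ → memBox (a , s′) T′) (fromTo (suc c) (proj₂ p))) c∈T′)
      (all-congᴬ (All-fromTo (suc c) (proj₂ p)) λ {s′} (c<s′ , _) →
        ≡.cong (_∨ memBox (a , s′) S) (eqBox-≢column {a} {s′} (a , c) (ℕₚ.>⇒≢ c<s′))))

-- a nonempty S missing column c cannot be closed
rowClosed-gap : ∀ a c S → All (λ p → proj₁ p ≡ a × suc c ≤ proj₂ p) S → rowClosed a c S ≡ null S
rowClosed-gap a c [] _ = ≡.refl
rowClosed-gap a c (p ∷ S) (p-right ∷ S-right) = ≡.cong (_∧ all (λ q → rowFilledTo a c (p ∷ S) (proj₂ q)) S)
  (≡.trans (≡.cong (all (λ s′ → memBox (a , s′) (p ∷ S))) (fromTo-step (ℕₚ.<⇒≤ (proj₂ p-right))))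
    (≡.cong (_∧ all (λ s′ → memBox (a , s′) (p ∷ S)) (fromTo (suc c) (proj₂ p)))
      (memBox-otherColumns {a} {c} (p ∷ S) (All.map (λ (_ , c<s) → ℕₚ.>⇒≢ c<s) (p-right ∷ S-right)))))

private
  ≤ᵇ-downClosed : ∀ u {s s′} → s′ ≤ s → (s ≤ᵇ u) ≡ true → (s′ ≤ᵇ u) ≡ true
  ≤ᵇ-downClosed u s′≤s e = ≤ᵇ-true (≤-trans s′≤s (≤ᵇ-true⁻ e))

  all-map : ∀ {A B : Set} (f : B → Bool) (g : A → B) xs → all f (map g xs) ≡ all (f ∘ g) xs
  all-map f g [] = ≡.refl
  all-map f g (x ∷ xs) = ≡.cong (f (g x) ∧_) (all-map f g xs)

columnsWithin-rowBoxes : ∀ a {γ z u} → γ ≤ z → γ ≤ u → columnsWithin u (rowBoxes a (suc γ) z) ≡ (z ≤ᵇ u)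
columnsWithin-rowBoxes a {γ} {z} {u} γ≤z γ≤u with γ ≟ z
... | yes ≡.refl rewrite rowBoxes-empty a (n<1+n γ) = ≡.sym (≤ᵇ-true γ≤u)
... | no γ≢z = ≡.trans (all-map (λ p → proj₂ p ≤ᵇ u) (a ,_) (fromTo (suc γ) z))
                       (all-fromTo-downClosed (_≤ᵇ u) (≤ᵇ-downClosed u) (ℕₚ.≤∧≢⇒< γ≤z γ≢z))

rowFilledTo-rowBoxes : ∀ a {γ z s} → suc γ ≤ s → rowFilledTo a (suc γ) (rowBoxes a (suc γ) z) s ≡ (s ≤ᵇ z)
rowFilledTo-rowBoxes a {γ} {z} {s} γ<s =
  ≡.trans (all-congᴬ (All-fromTo (suc γ) s) (λ (γ<s′ , _) → memBox-rowBoxes a z γ<s′))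
          (all-fromTo-downClosed (_≤ᵇ z) (≤ᵇ-downClosed z) γ<s)

columnsWithin-mono : ∀ {z u} μ → z ≤ u → columnsWithin z μ ≡ true → columnsWithin u μ ≡ true
columnsWithin-mono [] z≤u _ = ≡.refl
columnsWithin-mono {z} (p ∷ μ) z≤u within with proj₂ p ≤ᵇ z in e
... | true = ≡.cong₂ _∧_ (≤ᵇ-true (≤-trans (≤ᵇ-true⁻ {proj₂ p} e) z≤u)) (columnsWithin-mono μ z≤u within)

compatibleBelow-rowBoxes : ∀ a {γ z u} μ → All (λ p → suc γ ≤ proj₂ p) μ → γ ≤ z → γ ≤ u →
  compatibleBelow a (suc γ) u (rowBoxes a (suc γ) z) μ ≡ (z ≤ᵇ u) ∧ boundedSubdiagram (suc a) (suc γ) z μ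
compatibleBelow-rowBoxes a {γ} {z} {u} μ μ-right γ≤z γ≤u =
  ≡.trans (≡.cong₂ (λ b₁ b₂ → (b₁ ∧ columnsWithin u μ) ∧ (b₂ ∧ isSubdiagram (suc a) (suc γ) μ))
                   (columnsWithin-rowBoxes a γ≤z γ≤u)
                   (all-congᴬ μ-right (rowFilledTo-rowBoxes a)))
          (simplify (z ≤ᵇ u) ≡.refl (columnsWithin z μ) ≡.refl)
  where
  simplify : ∀ b → (z ≤ᵇ u) ≡ b → ∀ b′ → columnsWithin z μ ≡ b′ →
    (b ∧ columnsWithin u μ) ∧ (b′ ∧ isSubdiagram (suc a) (suc γ) μ) ≡ b ∧ (b′ ∧ isSubdiagram (suc a) (suc γ) μ)
  simplify false _ _ _ = ≡.refl
  simplify true z≤u true within = ≡.cong (_∧ isSubdiagram (suc a) (suc γ) μ) (columnsWithin-mono μ (≤ᵇ-true⁻ z≤u) within)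
  simplify true _ false _ = ∧-zeroʳ (columnsWithin u μ)

boundedSubdiagram-++ : ∀ a c u S μ → All (λ p → proj₁ p ≡ a) S → All (λ p → suc a ≤ proj₁ p) μ →
  boundedSubdiagram a c u (S ++ μ) ≡ rowClosed a c S ∧ compatibleBelow a c u S μ
boundedSubdiagram-++ a c u S μ S-in-a μ-below =
  ≡.trans (≡.cong₂ _∧_ (all-++ (λ p → proj₂ p ≤ᵇ u) S μ) (isSubdiagram-++ a c S μ S-in-a μ-below))
          (swap-∧ (columnsWithin u S ∧ columnsWithin u μ) (rowClosed a c S) _)
  where
  swap-∧ : ∀ x y z → x ∧ (y ∧ z) ≡ y ∧ (x ∧ z)
  swap-∧ x true z = ≡.refl
  swap-∧ x false z = ∧-zeroʳ x

module BessenrodtStanley {c ℓ} (R : CommutativeRing c ℓ) (l : List ℕ) (l↓ : Linked _≥_ l)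
                         (x : ℕ → ℕ → CommutativeRing.Carrier R) where

  open CommutativeRing R hiding (zero) renaming (_+_ to _⊕_; _*_ to _⊗_)
  open import Algebra.Properties.CommutativeSemigroup *-commutativeSemigroup using (x∙yz≈y∙xz)
  open import Algebra.Properties.CommutativeSemigroup +-commutativeSemigroup using (interchange)
  open import Relation.Binary.Reasoning.Setoid setoid
  open FiniteSums R
  open Determinant R

  -- Generating functions by rows

  rowTail : ℕ → ℕ → Carrier
  rowTail s z = prodFrom (x s) (suc z) (row l s ∸ z)

  -- gf k s lo hi is the generating function, by the boxes outside μ, of the sub-diagrams μ of
  -- rows s, …, s+k-1 of λ restricted to columns > lo whose first row ends at a column ≤ hi;
  -- z is the last column of the first row of μ.
  gf : ℕ → ℕ → ℕ → ℕ → Carrier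
  gf zero s lo hi = 1#
  gf (suc k) s lo hi = sumFrom (λ z → if z ≤ᵇ hi then rowTail s z ⊗ gf k (suc s) lo z else 0#) lo (suc (row l s) ∸ lo)

  gf-empty : ∀ k s {lo hi} → hi < lo → gf (suc k) s lo hi ≈ 0#
  gf-empty k s {lo} hi<lo = sumFrom-zero (suc (row l s) ∸ lo) lo λ lo≤z → reflexive (if-false (≤ᵇ-false (<-≤-trans hi<lo lo≤z)))

  -- either the last row of μ stops at column lo, or every row of μ reaches column lo + 1
  gf-peelLastRow : ∀ k s {lo hi} → 1 ≤ s → lo ≤ row l (s + k) → lo ≤ hi →
    gf (suc k) s lo hi ≈ rowTail (s + k) lo ⊗ gf k s lo hi ⊕ gf (suc k) s (suc lo) hi
  gf-peelLastRow zero s {lo} {hi} 1≤s lo≤λ lo≤hi = begin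
    sumFrom F lo (suc (row l s) ∸ lo)                   ≡⟨ ≡.cong (sumFrom F lo) (ℕₚ.+-∸-assoc 1 lo≤λₛ) ⟩
    F lo ⊕ sumFrom F (suc lo) (row l s ∸ lo)            ≡⟨ ≡.cong (_⊕ sumFrom F (suc lo) (row l s ∸ lo)) (if-true (≤ᵇ-true lo≤hi)) ⟩
    rowTail s lo ⊗ 1# ⊕ gf 1 s (suc lo) hi              ≡⟨ ≡.cong (λ r → rowTail r lo ⊗ 1# ⊕ gf 1 s (suc lo) hi) (≡.sym (ℕₚ.+-identityʳ s)) ⟩
    rowTail (s + 0) lo ⊗ 1# ⊕ gf 1 s (suc lo) hi        ∎
    where
    F : ℕ → Carrier
    F z = if z ≤ᵇ hi then rowTail s z ⊗ 1# else 0#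
    lo≤λₛ : lo ≤ row l s
    lo≤λₛ = ≡.subst (λ r → lo ≤ row l r) (ℕₚ.+-identityʳ s) lo≤λ
  gf-peelLastRow (suc k) s {lo} {hi} 1≤s lo≤λ lo≤hi = begin
    sumFrom F lo count                                     ≈⟨ sumFrom-cong count lo split ⟩
    sumFrom (λ z → v ⊗ F₁ z ⊕ F₂ z) lo count               ≈⟨ sumFrom-+ count lo _ F₂ ⟩
    sumFrom (λ z → v ⊗ F₁ z) lo count ⊕ sumFrom F₂ lo count ≈⟨ +-congʳ (sumFrom-*ˡ count lo v F₁) ⟩
    v ⊗ gf (suc k) s lo hi ⊕ sumFrom F₂ lo count           ≡⟨ ≡.cong (λ m → v ⊗ gf (suc k) s lo hi ⊕ sumFrom F₂ lo m) (ℕₚ.+-∸-assoc 1 lo≤λₛ) ⟩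
    v ⊗ gf (suc k) s lo hi ⊕ (F₂ lo ⊕ sumFrom F₂ (suc lo) (row l s ∸ lo))
      ≈⟨ +-congˡ (trans (+-congʳ F₂-lo) (+-identityˡ _)) ⟩
    v ⊗ gf (suc k) s lo hi ⊕ gf (suc (suc k)) s (suc lo) hi ∎
    where
    count : ℕ
    count = suc (row l s) ∸ lo
    v : Carrier
    v = rowTail (s + suc k) lo
    lo≤λₛ : lo ≤ row l s
    lo≤λₛ = ≤-trans lo≤λ (row-antitone l l↓ 1≤s (m≤m+n s (suc k)))
    F F₁ F₂ : ℕ → Carrier
    F z = if z ≤ᵇ hi then rowTail s z ⊗ gf (suc k) (suc s) lo z else 0#
    F₁ z = if z ≤ᵇ hi then rowTail s z ⊗ gf k (suc s) lo z else 0#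
    F₂ z = if z ≤ᵇ hi then rowTail s z ⊗ gf (suc k) (suc s) (suc lo) z else 0#
    split : ∀ {z} → lo ≤ z → F z ≈ v ⊗ F₁ z ⊕ F₂ z
    split {z} lo≤z with z ≤ᵇ hi
    ... | true = begin
      rowTail s z ⊗ gf (suc k) (suc s) lo z
        ≈⟨ *-congˡ (gf-peelLastRow k (suc s) (s≤s z≤n) (≡.subst (λ r → lo ≤ row l r) (ℕₚ.+-suc s k) lo≤λ) lo≤z) ⟩
      rowTail s z ⊗ (rowTail (suc s + k) lo ⊗ gf k (suc s) lo z ⊕ gf (suc k) (suc s) (suc lo) z)
        ≈⟨ trans (distribˡ _ _ _) (+-congʳ (x∙yz≈y∙xz _ _ _)) ⟩
      rowTail (suc s + k) lo ⊗ (rowTail s z ⊗ gf k (suc s) lo z) ⊕ rowTail s z ⊗ gf (suc k) (suc s) (suc lo) z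
        ≡⟨ ≡.cong (λ r → rowTail r lo ⊗ (rowTail s z ⊗ gf k (suc s) lo z) ⊕ rowTail s z ⊗ gf (suc k) (suc s) (suc lo) z)
                  (≡.sym (ℕₚ.+-suc s k)) ⟩
      v ⊗ (rowTail s z ⊗ gf k (suc s) lo z) ⊕ rowTail s z ⊗ gf (suc k) (suc s) (suc lo) z ∎
    ... | false = sym (trans (+-identityʳ _) (zeroʳ _))
    F₂-lo : F₂ lo ≈ 0#
    F₂-lo with lo ≤ᵇ hi
    ... | true = trans (*-congˡ (gf-empty k (suc s) (n<1+n lo))) (zeroʳ _)
    ... | false = refl

  gf-lastRowTooShort : ∀ k s {lo} hi → 1 ≤ s → row l (s + k) < lo → gf (suc k) s lo hi ≈ 0#
  gf-lastRowTooShort zero s {lo} hi 1≤s short =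
    reflexive (≡.cong (sumFrom _ lo) (ℕₚ.m≤n⇒m∸n≡0 (≡.subst (λ r → suc (row l r) ≤ lo) (ℕₚ.+-identityʳ s) short)))
  gf-lastRowTooShort (suc k) s {lo} hi 1≤s short = sumFrom-zero (suc (row l s) ∸ lo) lo term
    where
    term : ∀ {z} → lo ≤ z → (if z ≤ᵇ hi then rowTail s z ⊗ gf (suc k) (suc s) lo z else 0#) ≈ 0#
    term {z} _ with z ≤ᵇ hi
    ... | true = trans (*-congˡ (gf-lastRowTooShort k (suc s) z (s≤s z≤n) (≡.subst (λ r → row l r < lo) (ℕₚ.+-suc s k) short))) (zeroʳ _)
    ... | false = refl

  gfRows : ℕ → ℕ → ℕ → Carrier
  gfRows s E lo = if s ≤ᵇ E then gf (E ∸ s) s lo (row l s) else 0#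

  gfRows-+ : ∀ s k lo → gfRows s (s + k) lo ≡ gf k s lo (row l s)
  gfRows-+ s k lo = ≡.trans (if-true (≤ᵇ-true (m≤m+n s k))) (≡.cong (λ m → gf m s lo (row l s)) (ℕₚ.m+n∸m≡n s k))

  gfRows-noRows : ∀ s lo → gfRows s s lo ≈ 1#
  gfRows-noRows s lo = reflexive (≡.trans (if-true (≤ᵇ-true (≤-refl {s}))) (≡.cong (λ m → gf m s lo (row l s)) (ℕₚ.n∸n≡0 s)))

  gfRows-below : ∀ s {E} lo → E < s → gfRows s E lo ≡ 0#
  gfRows-below s lo E<s = if-false (≤ᵇ-false E<s)

  gfRows-peel : ∀ s d lo → 1 ≤ s → lo ≤ row l d → gfRows s (suc d) lo ≈ rowTail d lo ⊗ gfRows s d lo ⊕ gfRows s (suc d) (suc lo)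
  gfRows-peel s d lo 1≤s lo≤λ with ℕₚ.<-cmp s (suc d)
  ... | tri< s≤d _ _ with ℕₚ.m≤n⇒∃[o]m+o≡n (≤-pred s≤d)
  ...   | k , ≡.refl = begin
    gfRows s (suc (s + k)) lo                                          ≡⟨ ≡.trans (≡.cong (λ E → gfRows s E lo) E≡) (gfRows-+ s (suc k) lo) ⟩
    gf (suc k) s lo (row l s)                                          ≈⟨ gf-peelLastRow k s 1≤s lo≤λ (≤-trans lo≤λ (row-antitone l l↓ 1≤s (m≤m+n s k))) ⟩
    rowTail (s + k) lo ⊗ gf k s lo (row l s) ⊕ gf (suc k) s (suc lo) (row l s)
      ≡⟨ ≡.cong₂ (λ g g′ → rowTail (s + k) lo ⊗ g ⊕ g′) (≡.sym (gfRows-+ s k lo))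
                 (≡.sym (≡.trans (≡.cong (λ E → gfRows s E (suc lo)) E≡) (gfRows-+ s (suc k) (suc lo)))) ⟩
    rowTail (s + k) lo ⊗ gfRows s (s + k) lo ⊕ gfRows s (suc (s + k)) (suc lo) ∎
    where
    E≡ : suc (s + k) ≡ s + suc k
    E≡ = ≡.sym (ℕₚ.+-suc s k)
  gfRows-peel s d lo 1≤s lo≤λ | tri≈ _ ≡.refl _ = begin
    gfRows (suc d) (suc d) lo        ≈⟨ trans (gfRows-noRows (suc d) lo) (sym (gfRows-noRows (suc d) (suc lo))) ⟩
    gfRows (suc d) (suc d) (suc lo)  ≈⟨ +-identityˡ _ ⟨
    0# ⊕ gfRows (suc d) (suc d) (suc lo)
      ≈⟨ +-congʳ (sym (trans (*-congˡ (reflexive (gfRows-below (suc d) lo (n<1+n d)))) (zeroʳ _))) ⟩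
    rowTail d lo ⊗ gfRows (suc d) d lo ⊕ gfRows (suc d) (suc d) (suc lo) ∎
  gfRows-peel s d lo 1≤s lo≤λ | tri> _ _ d<s = begin
    gfRows s (suc d) lo    ≡⟨ gfRows-below s lo d<s ⟩
    0#                     ≈⟨ +-identityʳ 0# ⟨
    0# ⊕ 0#                ≈⟨ +-cong (sym (trans (*-congˡ (reflexive (gfRows-below s lo (<-trans (n<1+n d) d<s)))) (zeroʳ _)))
                                     (reflexive (≡.sym (gfRows-below s (suc lo) d<s))) ⟩
    rowTail d lo ⊗ gfRows s d lo ⊕ gfRows s (suc d) (suc lo) ∎

  gfRows-lastRowTooShort : ∀ s d lo → 1 ≤ s → s ≤ d → row l d < lo → gfRows s (suc d) lo ≈ 0#
  gfRows-lastRowTooShort s d lo 1≤s s≤d short with ℕₚ.m≤n⇒∃[o]m+o≡n s≤d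
  ... | k , ≡.refl = trans (reflexive (≡.trans (≡.cong (λ E → gfRows s E lo) (≡.sym (ℕₚ.+-suc s k))) (gfRows-+ s (suc k) lo)))
                           (gf-lastRowTooShort k s (row l s) 1≤s short)

  gfRows-extendByRowOfLength : ∀ s d lo → 1 ≤ s → s ≤ d → row l d ≡ lo → gfRows s (suc d) lo ≈ gfRows s d lo
  gfRows-extendByRowOfLength s d lo 1≤s s≤d λ≡lo = begin
    gfRows s (suc d) lo                                      ≈⟨ gfRows-peel s d lo 1≤s (ℕₚ.≤-reflexive (≡.sym λ≡lo)) ⟩
    rowTail d lo ⊗ gfRows s d lo ⊕ gfRows s (suc d) (suc lo)  ≈⟨ +-cong (*-congʳ emptyTail)
                                                                        (gfRows-lastRowTooShort s d (suc lo) 1≤s s≤d (s≤s (ℕₚ.≤-reflexive λ≡lo))) ⟩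
    1# ⊗ gfRows s d lo ⊕ 0#                                   ≈⟨ trans (+-identityʳ _) (*-identityˡ _) ⟩
    gfRows s d lo                                             ∎
    where
    emptyTail : rowTail d lo ≈ 1#
    emptyTail = reflexive (≡.cong (prodFrom (x d) (suc lo)) (≡.trans (≡.cong (_∸ lo) λ≡lo) (ℕₚ.n∸n≡0 lo)))

  gfRows-extendByRowsOfLength : ∀ s H e lo → 1 ≤ s → s ≤ suc H → (∀ {d} → H < d → d ≤ H + e → row l d ≡ lo) →
    gfRows s (suc (H + e)) lo ≈ gfRows s (suc H) lo
  gfRows-extendByRowsOfLength s H zero lo _ _ _ = reflexive (≡.cong (λ m → gfRows s (suc m) lo) (ℕₚ.+-identityʳ H))
  gfRows-extendByRowsOfLength s H (suc e) lo 1≤s s≤1+H rows = begin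
    gfRows s (suc (H + suc e)) lo     ≡⟨ ≡.cong (λ m → gfRows s (suc m) lo) (ℕₚ.+-suc H e) ⟩
    gfRows s (suc (suc (H + e))) lo   ≈⟨ gfRows-extendByRowOfLength s (suc (H + e)) lo 1≤s (≤-trans s≤1+H (s≤s (m≤m+n H e)))
                                            (rows (s≤s (m≤m+n H e)) (ℕₚ.≤-reflexive (≡.sym (ℕₚ.+-suc H e)))) ⟩
    gfRows s (suc (H + e)) lo         ≈⟨ gfRows-extendByRowsOfLength s H e lo 1≤s s≤1+H
                                            (λ H<d d≤ → rows H<d (≤-trans d≤ (ℕₚ.+-monoʳ-≤ H (n≤1+n e)))) ⟩
    gfRows s (suc H) lo               ∎

  -- rows of length exactly γ only contribute their empty sub-row
  gfRows-extendToColumnLength : ∀ a γ E → 1 ≤ a → a ≤ suc E → E ≤ columnLength l γ → (∀ {d} → E < d → row l d ≤ γ) →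
    gfRows a (suc (columnLength l γ)) γ ≈ gfRows a (suc E) γ
  gfRows-extendToColumnLength a γ E 1≤a a≤1+E E≤D short = begin
    gfRows a (suc D) γ               ≡⟨ ≡.cong (λ m → gfRows a (suc m) γ) (≡.sym (ℕₚ.m+[n∸m]≡n E≤D)) ⟩
    gfRows a (suc (E + (D ∸ E))) γ   ≈⟨ gfRows-extendByRowsOfLength a E (D ∸ E) γ 1≤a a≤1+E lengthγ ⟩
    gfRows a (suc E) γ               ∎
    where
    D : ℕ
    D = columnLength l γ
    lengthγ : ∀ {d} → E < d → d ≤ E + (D ∸ E) → row l d ≡ γ
    lengthγ {d} E<d d≤ = ℕₚ.≤-antisym (short E<d)
      (≤columnLength⇒≤row l γ (≤-trans (s≤s z≤n) E<d) (≡.subst (d ≤_) (ℕₚ.m+[n∸m]≡n E≤D) d≤))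

  module SquareReduction (α β n : ℕ)
    (rowsOfSquare-long : ∀ {d} → 1 ≤ d → d < α + n → β + n ≤ suc (row l d))
    (rowBelowSquare-short : row l (α + n) < β + n)
    (diagonal≤columnLength : ∀ {j} → j < n → α + j ≤ columnLength l (β + j)) where

    K : Matrix
    K i j = gfRows (suc α + i) (suc α + j) (β + j)

    K-unitriangular : detℕ n K ≈ 1#
    K-unitriangular = detℕ-unitriangular n K (λ {i} {j} j<i _ → reflexive (gfRows-below (suc α + i) (β + j) (ℕₚ.+-monoʳ-< (suc α) j<i)))
                                             (λ {i} _ → gfRows-noRows (suc α + i) (β + i))

    private
      below-square : ∀ {i} → i < n → suc α + i ≤ α + n
      below-square {i} i<n = ≡.subst (_≤ α + n) (ℕₚ.+-suc α i) (ℕₚ.+-monoʳ-≤ α i<n)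

    laterColumns-inSpan : ∀ m j → j + m ≡ n → ∀ e → ColumnSpan n K j (λ i → gfRows (suc α + i) (suc α + j + e) (β + j))
    laterColumns-inSpan zero j j+0≡n e with ≡.trans (≡.sym (ℕₚ.+-identityʳ j)) j+0≡n
    ... | ≡.refl = none λ {i} i<n →
      gfRows-lastRowTooShort (suc α + i) (α + n + e) (β + n) (s≤s z≤n) (≤-trans (below-square i<n) (m≤m+n (α + n) e))
        (≤-<-trans (row-antitone l l↓ (≤-trans (s≤s z≤n) (below-square i<n)) (m≤m+n (α + n) e)) rowBelowSquare-short)
    laterColumns-inSpan (suc m) j j+m≡n zero =
      ColumnSpan-resp (ColumnSpan-column j<n) (λ {i} _ → reflexive (≡.cong (λ E → gfRows (suc α + i) E (β + j)) (ℕₚ.+-identityʳ (suc α + j))))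
      where
      j<n : j < n
      j<n = ≡.subst (j <_) j+m≡n (≡.subst (_≤ j + suc m) (ℕₚ.+-comm j 1) (ℕₚ.+-monoʳ-≤ j (s≤s z≤n)))
    laterColumns-inSpan (suc m) j j+m≡n (suc e) with β + j ≤? row l d
      where
      d : ℕ
      d = suc α + j + e
    ... | yes reaches = ColumnSpan-+ (ColumnSpan-scale (rowTail d (β + j)) (laterColumns-inSpan (suc m) j j+m≡n e))
                                     (ColumnSpan-weaken (laterColumns-inSpan m (suc j) (≡.trans (≡.sym (ℕₚ.+-suc j m)) j+m≡n) e))
                                     peel
      where
      d : ℕ
      d = suc α + j + e
      peel : ∀ {i} → i < n → gfRows (suc α + i) (suc α + j + suc e) (β + j)
                             ≈ rowTail d (β + j) ⊗ gfRows (suc α + i) d (β + j) ⊕ gfRows (suc α + i) (suc α + suc j + e) (β + suc j)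
      peel {i} _ = trans (reflexive (≡.cong (λ E → gfRows (suc α + i) E (β + j)) (ℕₚ.+-suc (suc α + j) e)))
                         (trans (gfRows-peel (suc α + i) d (β + j) (s≤s z≤n) reaches)
                                (+-congˡ (reflexive (≡.cong₂ (gfRows (suc α + i)) (≡.cong (λ k → suc k + e) (≡.sym (ℕₚ.+-suc α j)))
                                                                                  (≡.sym (ℕₚ.+-suc β j))))))
    ... | no ¬reaches = none λ {i} i<n →
      trans (reflexive (≡.cong (λ E → gfRows (suc α + i) E (β + j)) (ℕₚ.+-suc (suc α + j) e)))
            (gfRows-lastRowTooShort (suc α + i) d (β + j) (s≤s z≤n) (≤-trans (below-square i<n) α+n≤d) (≰⇒> ¬reaches))
      where
      d : ℕ
      d = suc α + j + e
      j<n : j < n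
      j<n = ≡.subst (j <_) j+m≡n (≡.subst (_≤ j + suc m) (ℕₚ.+-comm j 1) (ℕₚ.+-monoʳ-≤ j (s≤s z≤n)))
      α+n≤d : α + n ≤ d
      α+n≤d with α + n ≤? d
      ... | yes α+n≤d = α+n≤d
      ... | no α+n≰d = ⊥-elim (¬reaches (≤-pred (≤-trans (ℕₚ.+-monoʳ-< β j<n) (rowsOfSquare-long (s≤s z≤n) (≰⇒> α+n≰d)))))

    laterColumns : ∀ {j} → j < n → ∀ e → ColumnSpan n K (suc j) (λ i → gfRows (suc α + i) (suc α + suc j + e) (β + suc j))
    laterColumns {j} j<n = laterColumns-inSpan (n ∸ suc j) (suc j) (ℕₚ.m+[n∸m]≡n j<n)

    pivot : ℕ → Carrier
    pivot j = prodFrom (λ d → rowTail d (β + j)) (suc α + j) (columnLength l (β + j) ∸ (α + j))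

    column-decomposition : ∀ {j} → j < n → ∀ e → α + j + e ≤ columnLength l (β + j) →
      Σ (ℕ → Carrier) λ w → ColumnSpan n K (suc j) w ×
        (∀ {i} → i < n → gfRows (suc α + i) (suc α + j + e) (β + j) ≈ prodFrom (λ d → rowTail d (β + j)) (suc α + j) e ⊗ K i j ⊕ w i)
    column-decomposition {j} j<n zero _ = (λ _ → 0#) , none (λ _ → refl) , λ {i} _ →
      trans (reflexive (≡.cong (λ E → gfRows (suc α + i) E (β + j)) (ℕₚ.+-identityʳ (suc α + j))))
            (sym (trans (+-identityʳ _) (*-identityˡ _)))
    column-decomposition {j} j<n (suc e) bound with column-decomposition j<n e (≤-trans (ℕₚ.+-monoʳ-≤ (α + j) (n≤1+n e)) bound)
    ... | w , w∈span , decomposed = w′ , ColumnSpan-+ (ColumnSpan-scale v w∈span) (laterColumns j<n e) (λ _ → refl) , peeled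
      where
      d : ℕ
      d = suc α + j + e
      v : Carrier
      v = rowTail d (β + j)
      P : ℕ → Carrier
      P = prodFrom (λ d → rowTail d (β + j)) (suc α + j)
      w′ : ℕ → Carrier
      w′ i = v ⊗ w i ⊕ gfRows (suc α + i) (suc α + suc j + e) (β + suc j)
      reaches : β + j ≤ row l d
      reaches = ≤columnLength⇒≤row l (β + j) (s≤s z≤n) (≡.subst (_≤ columnLength l (β + j)) (ℕₚ.+-suc (α + j) e) bound)
      peeled : ∀ {i} → i < n → gfRows (suc α + i) (suc α + j + suc e) (β + j) ≈ P (suc e) ⊗ K i j ⊕ w′ i
      peeled {i} i<n = begin
        gfRows s (suc α + j + suc e) (β + j)                      ≡⟨ ≡.cong (λ E → gfRows s E (β + j)) (ℕₚ.+-suc (suc α + j) e) ⟩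
        gfRows s (suc d) (β + j)                                  ≈⟨ gfRows-peel s d (β + j) (s≤s z≤n) reaches ⟩
        v ⊗ gfRows s d (β + j) ⊕ gfRows s (suc d) (suc (β + j))   ≈⟨ +-cong (*-congˡ (decomposed i<n))
                                                                       (reflexive (≡.cong₂ (gfRows s) (≡.cong (λ k → suc k + e) (≡.sym (ℕₚ.+-suc α j)))
                                                                                                       (≡.sym (ℕₚ.+-suc β j)))) ⟩
        v ⊗ (P e ⊗ K i j ⊕ w i) ⊕ G′                              ≈⟨ trans (+-congʳ (distribˡ _ _ _)) (+-assoc _ _ _) ⟩
        v ⊗ (P e ⊗ K i j) ⊕ w′ i                                  ≈⟨ +-congʳ (*-assoc _ _ _) ⟨
        (v ⊗ P e) ⊗ K i j ⊕ w′ i                                  ≈⟨ +-congʳ (*-congʳ (prodFrom-snoc e (suc α + j) _)) ⟨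
        P (suc e) ⊗ K i j ⊕ w′ i                                  ∎
        where
        s : ℕ
        s = suc α + i
        G′ : Carrier
        G′ = gfRows s (suc α + suc j + e) (β + suc j)

    det-gfRows≈prod-pivot : detℕ n (λ i j → gfRows (suc α + i) (suc (columnLength l (β + j))) (β + j)) ≈ prod< n pivot
    det-gfRows≈prod-pivot = begin
      detℕ n (λ i j → gfRows (suc α + i) (suc (columnLength l (β + j))) (β + j))   ≈⟨ detℕ-columnReduction n _ K pivot reduce ⟩
      prod< n pivot ⊗ detℕ n K                                                       ≈⟨ *-congˡ K-unitriangular ⟩
      prod< n pivot ⊗ 1#                                                             ≈⟨ *-identityʳ _ ⟩
      prod< n pivot                                                                  ∎
      where
      reduce : ∀ {j} → j < n → Σ (ℕ → Carrier) λ w → ColumnSpan n K (suc j) w ×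
        (∀ {i} → i < n → gfRows (suc α + i) (suc (columnLength l (β + j))) (β + j) ≈ pivot j ⊗ K i j ⊕ w i)
      reduce {j} j<n with column-decomposition j<n (columnLength l (β + j) ∸ (α + j))
                            (ℕₚ.≤-reflexive (ℕₚ.m+[n∸m]≡n (diagonal≤columnLength j<n)))
      ... | w , w∈span , decomposed = w , w∈span , λ {i} i<n →
        trans (reflexive (≡.cong (λ z → gfRows (suc α + i) (suc z) (β + j)) (≡.sym (ℕₚ.m+[n∸m]≡n (diagonal≤columnLength j<n)))))
              (decomposed i<n)

  -- Sums over subsets of boxes

  weight : List Box → Carrier
  weight = prodBoxes R x

  weight-++ : ∀ xs ys → weight (xs ++ ys) ≈ weight xs ⊗ weight ys
  weight-++ [] ys = sym (*-identityˡ _)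
  weight-++ (y ∷ xs) ys = trans (*-congˡ (weight-++ xs ys)) (sym (*-assoc _ _ _))

  sumSubsets : (List Box × List Box → Carrier) → List Box → Carrier
  sumSubsets g L = sumL R (map g (subsets L))

  sumSubsets-∷ : ∀ g y ys → sumSubsets g (y ∷ ys) ≈ sumSubsets (λ (S , C) → g (y ∷ S , C) ⊕ g (S , y ∷ C)) ys
  sumSubsets-∷ g y ys = trans (sumL-concatMap g _ (subsets ys)) (sumL-map-cong (subsets ys) (λ _ → +-congˡ (+-identityʳ _)))

  sumSubsets-+ : ∀ (f g : List Box × List Box → Carrier) L → sumSubsets (λ p → f p ⊕ g p) L ≈ sumSubsets f L ⊕ sumSubsets g L
  sumSubsets-+ f g L = go (subsets L)
    where
    go : ∀ ps → sumL R (map (λ p → f p ⊕ g p) ps) ≈ sumL R (map f ps) ⊕ sumL R (map g ps)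
    go [] = sym (+-identityʳ 0#)
    go (p ∷ ps) = trans (+-congˡ (go ps)) (interchange _ _ _ _)

  sumSubsets-*ˡ : ∀ a (f : List Box × List Box → Carrier) L → sumSubsets (λ p → a ⊗ f p) L ≈ a ⊗ sumSubsets f L
  sumSubsets-*ˡ a f L = go (subsets L)
    where
    go : ∀ ps → sumL R (map (λ p → a ⊗ f p) ps) ≈ a ⊗ sumL R (map f ps)
    go [] = sym (zeroʳ a)
    go (p ∷ ps) = trans (+-congˡ (go ps)) (sym (distribˡ a _ _))

  sumSubsets-zero : ∀ L → sumSubsets (λ _ → 0#) L ≈ 0#
  sumSubsets-zero L = go (subsets L)
    where
    go : ∀ (ps : List (List Box × List Box)) → sumL R (map (λ _ → 0#) ps) ≈ 0#
    go [] = refl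
    go (p ∷ ps) = trans (+-congˡ (go ps)) (+-identityʳ 0#)

  sumSubsets-congᴬ : ∀ {Q : Box → Set} L → All Q L → {f g : List Box × List Box → Carrier} →
    (∀ S C → All Q S → f (S , C) ≈ g (S , C)) → sumSubsets f L ≈ sumSubsets g L
  sumSubsets-congᴬ [] [] h = +-congʳ (h [] [] [])
  sumSubsets-congᴬ (y ∷ ys) (qy ∷ qs) {f} {g} h = begin
    sumSubsets f (y ∷ ys)                                                ≈⟨ sumSubsets-∷ f y ys ⟩
    sumSubsets (λ (S , C) → f (y ∷ S , C) ⊕ f (S , y ∷ C)) ys            ≈⟨ sumSubsets-congᴬ ys qs (λ S C qS → +-cong (h (y ∷ S) C (qy ∷ qS)) (h S (y ∷ C) qS)) ⟩
    sumSubsets (λ (S , C) → g (y ∷ S , C) ⊕ g (S , y ∷ C)) ys            ≈⟨ sumSubsets-∷ g y ys ⟨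
    sumSubsets g (y ∷ ys)                                                ∎

  sumSubsets-cong : ∀ L {f g : List Box × List Box → Carrier} → (∀ S C → f (S , C) ≈ g (S , C)) → sumSubsets f L ≈ sumSubsets g L
  sumSubsets-cong L h = sumSubsets-congᴬ {Q = λ _ → ⊤} L (All.universal _ L) (λ S C _ → h S C)

  sumSubsets-++ : ∀ g xs ys → sumSubsets g (xs ++ ys) ≈ sumSubsets (λ (S , C) → sumSubsets (λ (S′ , C′) → g (S ++ S′ , C ++ C′)) ys) xs
  sumSubsets-++ g [] ys = sym (+-identityʳ _)
  sumSubsets-++ g (y ∷ xs) ys = begin
    sumSubsets g (y ∷ (xs ++ ys))                                ≈⟨ sumSubsets-∷ g y (xs ++ ys) ⟩
    sumSubsets g₁ (xs ++ ys)                                     ≈⟨ sumSubsets-++ g₁ xs ys ⟩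
    sumSubsets (λ (S , C) → sumSubsets (λ (S′ , C′) → g₁ (S ++ S′ , C ++ C′)) ys) xs
      ≈⟨ sumSubsets-cong xs (λ S C → sumSubsets-+ _ _ ys) ⟩
    sumSubsets (λ (S , C) → sumSubsets (λ (S′ , C′) → g (y ∷ S ++ S′ , C ++ C′)) ys ⊕ sumSubsets (λ (S′ , C′) → g (S ++ S′ , y ∷ C ++ C′)) ys) xs
      ≈⟨ sumSubsets-∷ (λ (S , C) → sumSubsets (λ (S′ , C′) → g (S ++ S′ , C ++ C′)) ys) y xs ⟨
    sumSubsets (λ (S , C) → sumSubsets (λ (S′ , C′) → g (S ++ S′ , C ++ C′)) ys) (y ∷ xs) ∎
    where
    g₁ : List Box × List Box → Carrier
    g₁ (S , C) = g (y ∷ S , C) ⊕ g (S , y ∷ C)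

  sumSubsets-onlyEmpty : ∀ (h : List Box → Carrier) L → sumSubsets (λ (S , C) → if null S then h C else 0#) L ≈ h L
  sumSubsets-onlyEmpty h [] = +-identityʳ _
  sumSubsets-onlyEmpty h (y ∷ ys) =
    trans (sumSubsets-∷ _ y ys) (trans (sumSubsets-cong ys (λ S C → +-identityˡ _)) (sumSubsets-onlyEmpty (h ∘ (y ∷_)) ys))

  sumSubsets-if : ∀ (b : Bool) (g : List Box × List Box → Carrier) L →
    sumSubsets (λ p → if b then g p else 0#) L ≈ (if b then sumSubsets g L else 0#)
  sumSubsets-if true g L = refl
  sumSubsets-if false g L = sumSubsets-zero L

  if-cong : ∀ b {X Y} → X ≈ Y → (if b then X else 0#) ≈ (if b then Y else 0#)
  if-cong true X≈Y = X≈Y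
  if-cong false _ = refl

  if-∧ : ∀ b b′ (X : Carrier) → (if b ∧ b′ then X else 0#) ≡ (if b then (if b′ then X else 0#) else 0#)
  if-∧ true b′ X = ≡.refl
  if-∧ false b′ X = ≡.refl

  *-if : ∀ b A B → A ⊗ (if b then B else 0#) ≈ (if b then A ⊗ B else 0#)
  *-if true A B = refl
  *-if false A B = zeroʳ A

  weight-rowBoxes : ∀ a lo hi → weight (rowBoxes a lo hi) ≡ prodFrom (x a) lo (suc hi ∸ lo)
  weight-rowBoxes a lo hi =
    ≡.trans (weight-map (fromTo lo hi)) (≡.trans (≡.cong (prodL R ∘ map (x a)) (fromTo≡countFrom lo hi)) (prodL-countFrom (x a) lo (suc hi ∸ lo)))
    where
    weight-map : ∀ zs → weight (map (a ,_) zs) ≡ prodL R (map (x a) zs)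
    weight-map [] = ≡.refl
    weight-map (z ∷ zs) = ≡.cong (x a z ⊗_) (weight-map zs)

  -- the rows below row a, when row a of the diagram is S
  belowSum : ℕ → ℕ → ℕ → List Box → List Box → Carrier
  belowSum a c u S ys = sumSubsets (λ (μ , C) → if compatibleBelow a c u S μ then weight C else 0#) ys

  sumSubsets-splitRow : ∀ a c u S C ys → All (λ p → proj₁ p ≡ a) S → All (λ p → suc a ≤ proj₁ p) ys →
    sumSubsets (λ (μ , C′) → if boundedSubdiagram a c u (S ++ μ) then weight (C ++ C′) else 0#) ys
      ≈ (if rowClosed a c S then weight C ⊗ belowSum a c u S ys else 0#)
  sumSubsets-splitRow a c u S C ys S-in-a ys-below = begin
    sumSubsets (λ (μ , C′) → if boundedSubdiagram a c u (S ++ μ) then weight (C ++ C′) else 0#) ys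
      ≈⟨ sumSubsets-congᴬ ys ys-below split ⟩
    sumSubsets (λ (μ , C′) → if rowClosed a c S then weight C ⊗ (if compatibleBelow a c u S μ then weight C′ else 0#) else 0#) ys
      ≈⟨ sumSubsets-if (rowClosed a c S) _ ys ⟩
    (if rowClosed a c S then sumSubsets (λ (μ , C′) → weight C ⊗ (if compatibleBelow a c u S μ then weight C′ else 0#)) ys else 0#)
      ≈⟨ if-cong (rowClosed a c S) (sumSubsets-*ˡ (weight C) _ ys) ⟩
    (if rowClosed a c S then weight C ⊗ belowSum a c u S ys else 0#) ∎
    where
    split : ∀ μ C′ → All (λ p → suc a ≤ proj₁ p) μ →
      (if boundedSubdiagram a c u (S ++ μ) then weight (C ++ C′) else 0#)
        ≈ (if rowClosed a c S then weight C ⊗ (if compatibleBelow a c u S μ then weight C′ else 0#) else 0#)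
    split μ C′ μ-below = begin
      (if boundedSubdiagram a c u (S ++ μ) then weight (C ++ C′) else 0#)
        ≡⟨ ≡.cong (λ b → if b then weight (C ++ C′) else 0#) (boundedSubdiagram-++ a c u S μ S-in-a μ-below) ⟩
      (if rowClosed a c S ∧ compatibleBelow a c u S μ then weight (C ++ C′) else 0#)
        ≈⟨ if-cong (rowClosed a c S ∧ compatibleBelow a c u S μ) (weight-++ C C′) ⟩
      (if rowClosed a c S ∧ compatibleBelow a c u S μ then weight C ⊗ weight C′ else 0#)
        ≡⟨ if-∧ (rowClosed a c S) (compatibleBelow a c u S μ) _ ⟩
      (if rowClosed a c S then (if compatibleBelow a c u S μ then weight C ⊗ weight C′ else 0#) else 0#)
        ≈⟨ if-cong (rowClosed a c S) (*-if (compatibleBelow a c u S μ) (weight C) (weight C′)) ⟨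
      (if rowClosed a c S then weight C ⊗ (if compatibleBelow a c u S μ then weight C′ else 0#) else 0#) ∎

  -- the closed subsets of a row segment are its initial segments
  sumSubsets-initialSegments : ∀ a γ k (Φ : List Box → Carrier) →
    sumSubsets (λ (S , C) → if rowClosed a (suc γ) S then weight C ⊗ Φ S else 0#) (rowBoxes a (suc γ) (γ + k))
      ≈ sumFrom (λ z → weight (rowBoxes a (suc z) (γ + k)) ⊗ Φ (rowBoxes a (suc γ) z)) γ (suc k)
  sumSubsets-initialSegments a γ zero Φ = begin
    sumSubsets g (rowBoxes a (suc γ) (γ + 0))    ≡⟨ ≡.cong (sumSubsets g) empty ⟩
    (1# ⊗ Φ []) ⊕ 0#                             ≡⟨ ≡.cong₂ (λ S S′ → (weight S ⊗ Φ S′) ⊕ 0#) (≡.sym empty) (≡.sym (rowBoxes-empty a (n<1+n γ))) ⟩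
    weight (rowBoxes a (suc γ) (γ + 0)) ⊗ Φ (rowBoxes a (suc γ) γ) ⊕ 0# ∎
    where
    g : List Box × List Box → Carrier
    g (S , C) = if rowClosed a (suc γ) S then weight C ⊗ Φ S else 0#
    empty : rowBoxes a (suc γ) (γ + 0) ≡ []
    empty = rowBoxes-empty a (s≤s (ℕₚ.≤-reflexive (ℕₚ.+-identityʳ γ)))
  sumSubsets-initialSegments a γ (suc k) Φ = begin
    sumSubsets g (rowBoxes a (suc γ) (γ + suc k))    ≡⟨ ≡.cong (sumSubsets g) segment ⟩
    sumSubsets g (y ∷ ys)                            ≈⟨ sumSubsets-∷ g y ys ⟩
    sumSubsets (λ (S , C) → g (y ∷ S , C) ⊕ g (S , y ∷ C)) ys
      ≈⟨ sumSubsets-congᴬ ys ys-right (λ S C S-right → +-cong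
           (reflexive (≡.cong (λ b → if b then weight C ⊗ Φ (y ∷ S) else 0#) (rowClosed-∷ a (suc γ) S S-right)))
           (trans (reflexive (≡.cong (λ b → if b then weight (y ∷ C) ⊗ Φ S else 0#) (rowClosed-gap a (suc γ) S S-right)))
                  (onlyEmpty S (weight (y ∷ C))))) ⟩
    sumSubsets (λ p → g₁ p ⊕ g₂ p) ys                ≈⟨ sumSubsets-+ g₁ g₂ ys ⟩
    sumSubsets g₁ ys ⊕ sumSubsets g₂ ys              ≈⟨ +-cong (sumSubsets-initialSegments a (suc γ) k (Φ ∘ (y ∷_)))
                                                               (sumSubsets-onlyEmpty (λ C → weight (y ∷ C) ⊗ Φ []) ys) ⟩
    sumFrom (λ z → weight (rowBoxes a (suc z) (suc γ + k)) ⊗ Φ (y ∷ rowBoxes a (suc (suc γ)) z)) (suc γ) (suc k) ⊕ weight (y ∷ ys) ⊗ Φ []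
      ≈⟨ +-comm _ _ ⟩
    weight (y ∷ ys) ⊗ Φ [] ⊕ sumFrom (λ z → weight (rowBoxes a (suc z) (suc γ + k)) ⊗ Φ (y ∷ rowBoxes a (suc (suc γ)) z)) (suc γ) (suc k)
      ≈⟨ +-cong (reflexive (≡.cong₂ (λ S S′ → weight S ⊗ Φ S′) (≡.sym segment) (≡.sym (rowBoxes-empty a (n<1+n γ)))))
                (sumFrom-cong (suc k) (suc γ) (λ {z} γ<z → reflexive (≡.cong₂ (λ m S → weight (rowBoxes a (suc z) m) ⊗ Φ S)
                                                                         (≡.sym (ℕₚ.+-suc γ k)) (≡.sym (rowBoxes-step a γ<z))))) ⟩
    F γ ⊕ sumFrom F (suc γ) (suc k) ∎
    where
    g : List Box × List Box → Carrier
    g (S , C) = if rowClosed a (suc γ) S then weight C ⊗ Φ S else 0#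
    y : Box
    y = (a , suc γ)
    ys : List Box
    ys = rowBoxes a (suc (suc γ)) (suc γ + k)
    segment : rowBoxes a (suc γ) (γ + suc k) ≡ y ∷ ys
    segment = ≡.trans (≡.cong (rowBoxes a (suc γ)) (ℕₚ.+-suc γ k)) (rowBoxes-step a (s≤s (m≤m+n γ k)))
    ys-right : All (λ p → proj₁ p ≡ a × suc (suc γ) ≤ proj₂ p) ys
    ys-right = All.map (λ (in-a , γ<s , _) → in-a , γ<s) (All-rowBoxes a (suc (suc γ)) (suc γ + k))
    onlyEmpty : ∀ S A → (if null S then A ⊗ Φ S else 0#) ≈ (if null S then A ⊗ Φ [] else 0#)
    onlyEmpty [] A = refl
    onlyEmpty (_ ∷ _) A = refl
    g₁ g₂ : List Box × List Box → Carrier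
    g₁ (S , C) = if rowClosed a (suc (suc γ)) S then weight C ⊗ Φ (y ∷ S) else 0#
    g₂ (S , C) = if null S then weight (y ∷ C) ⊗ Φ [] else 0#
    F : ℕ → Carrier
    F z = weight (rowBoxes a (suc z) (γ + suc k)) ⊗ Φ (rowBoxes a (suc γ) z)

  boundedSum : ℕ → ℕ → ℕ → Carrier
  boundedSum c a u = sumSubsets (λ (μ , C) → if boundedSubdiagram a c u μ then weight C else 0#) (boxesSE l a c)

  belowSum-rowBoxes : ∀ a {γ z u} ys → All (λ p → suc γ ≤ proj₂ p) ys → γ ≤ z → γ ≤ u →
    belowSum a (suc γ) u (rowBoxes a (suc γ) z) ys
      ≈ (if z ≤ᵇ u then sumSubsets (λ (μ , C) → if boundedSubdiagram (suc a) (suc γ) z μ then weight C else 0#) ys else 0#)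
  belowSum-rowBoxes a {γ} {z} {u} ys ys-right γ≤z γ≤u = begin
    belowSum a (suc γ) u (rowBoxes a (suc γ) z) ys
      ≈⟨ sumSubsets-congᴬ ys ys-right (λ μ C μ-right → reflexive
           (≡.trans (≡.cong (λ b → if b then weight C else 0#) (compatibleBelow-rowBoxes a μ μ-right γ≤z γ≤u))
                    (if-∧ (z ≤ᵇ u) (boundedSubdiagram (suc a) (suc γ) z μ) (weight C)))) ⟩
    sumSubsets (λ (μ , C) → if z ≤ᵇ u then (if boundedSubdiagram (suc a) (suc γ) z μ then weight C else 0#) else 0#) ys
      ≈⟨ sumSubsets-if (z ≤ᵇ u) _ ys ⟩
    (if z ≤ᵇ u then sumSubsets (λ (μ , C) → if boundedSubdiagram (suc a) (suc γ) z μ then weight C else 0#) ys else 0#) ∎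

  -- the first row of μ is the segment of row a from column γ + 1 to some column z ≥ γ
  boundedSum-byFirstRow : ∀ γ a u → γ < row l a → a ≤ length l →
    boundedSum (suc γ) a u
      ≈ sumFrom (λ z → rowTail a z ⊗ belowSum a (suc γ) u (rowBoxes a (suc γ) z) (boxesSE l (suc a) (suc γ))) γ (suc (row l a ∸ γ))
  boundedSum-byFirstRow γ a u γ<λₐ a≤N = begin
    boundedSum (suc γ) a u
      ≡⟨ ≡.cong (sumSubsets g) (boxesSE-step l (suc γ) a≤N) ⟩
    sumSubsets g (rowBoxes a (suc γ) (row l a) ++ lower)
      ≈⟨ sumSubsets-++ g (rowBoxes a (suc γ) (row l a)) lower ⟩
    sumSubsets (λ (S , C) → sumSubsets (λ (S′ , C′) → g (S ++ S′ , C ++ C′)) lower) (rowBoxes a (suc γ) (row l a))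
      ≈⟨ sumSubsets-congᴬ (rowBoxes a (suc γ) (row l a)) (All.map proj₁ (All-rowBoxes a (suc γ) (row l a)))
                          (λ S C S-in-a → sumSubsets-splitRow a (suc γ) u S C lower S-in-a lower-below) ⟩
    sumSubsets h (rowBoxes a (suc γ) (row l a))
      ≡⟨ ≡.cong (sumSubsets h ∘ rowBoxes a (suc γ)) (≡.sym γ+k≡λₐ) ⟩
    sumSubsets h (rowBoxes a (suc γ) (γ + k))
      ≈⟨ sumSubsets-initialSegments a γ k (λ S → belowSum a (suc γ) u S lower) ⟩
    sumFrom (λ z → weight (rowBoxes a (suc z) (γ + k)) ⊗ belowSum a (suc γ) u (rowBoxes a (suc γ) z) lower) γ (suc k)
      ≈⟨ sumFrom-cong (suc k) γ (λ {z} _ → *-congʳ (reflexive (≡.trans (≡.cong (weight ∘ rowBoxes a (suc z)) γ+k≡λₐ)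
                                                                       (weight-rowBoxes a (suc z) (row l a))))) ⟩
    sumFrom (λ z → rowTail a z ⊗ belowSum a (suc γ) u (rowBoxes a (suc γ) z) lower) γ (suc k) ∎
    where
    lower : List Box
    lower = boxesSE l (suc a) (suc γ)
    g h : List Box × List Box → Carrier
    g (μ , C) = if boundedSubdiagram a (suc γ) u μ then weight C else 0#
    h (S , C) = if rowClosed a (suc γ) S then weight C ⊗ belowSum a (suc γ) u S lower else 0#
    k : ℕ
    k = row l a ∸ γ
    γ+k≡λₐ : γ + k ≡ row l a
    γ+k≡λₐ = ℕₚ.m+[n∸m]≡n (ℕₚ.<⇒≤ γ<λₐ)
    lower-below : All (λ p → suc a ≤ proj₁ p) lower
    lower-below = All.map proj₁ (All-boxesSE l (suc a) (suc γ))

  -- only the rows of length > γ meet λ_{a,γ+1}; there are columnLength l (suc γ) of them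
  boundedSum≈gf : ∀ γ m a u → a + m ≡ suc (columnLength l (suc γ)) → 1 ≤ a → γ ≤ u → boundedSum (suc γ) a u ≈ gf m a γ u
  boundedSum≈gf γ zero a u a+0≡ _ _ = begin
    boundedSum (suc γ) a u   ≡⟨ ≡.cong (sumSubsets _) (boxesSE-empty l a (suc γ) short) ⟩
    1# ⊕ 0#                  ≈⟨ +-identityʳ 1# ⟩
    1#                       ∎
    where
    short : ∀ {i} → a ≤ i → row l i < suc γ
    short a≤i = row<-beyondColumnLength l l↓ γ (≤-trans (ℕₚ.≤-reflexive (≡.trans (≡.sym a+0≡) (ℕₚ.+-identityʳ a))) a≤i)
  boundedSum≈gf γ (suc m) a u a+m≡ 1≤a γ≤u = begin
    boundedSum (suc γ) a u
      ≈⟨ boundedSum-byFirstRow γ a u γ<λₐ (≤-trans a≤H (columnLength≤length l (suc γ))) ⟩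
    sumFrom (λ z → rowTail a z ⊗ belowSum a (suc γ) u (rowBoxes a (suc γ) z) (boxesSE l (suc a) (suc γ))) γ (suc (row l a ∸ γ))
      ≈⟨ sumFrom-cong (suc (row l a ∸ γ)) γ term ⟩
    sumFrom (λ z → if z ≤ᵇ u then rowTail a z ⊗ gf m (suc a) γ z else 0#) γ (suc (row l a ∸ γ))
      ≡⟨ ≡.cong (sumFrom _ γ) (≡.sym (ℕₚ.+-∸-assoc 1 (ℕₚ.<⇒≤ γ<λₐ))) ⟩
    gf (suc m) a γ u ∎
    where
    a≤H : a ≤ columnLength l (suc γ)
    a≤H = ≤-pred (≡.subst (a <_) a+m≡ (≡.subst (_≤ a + suc m) (ℕₚ.+-comm a 1) (ℕₚ.+-monoʳ-≤ a (s≤s z≤n))))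
    γ<λₐ : suc γ ≤ row l a
    γ<λₐ = ≤columnLength⇒≤row l (suc γ) 1≤a a≤H
    lower-right : All (λ p → suc γ ≤ proj₂ p) (boxesSE l (suc a) (suc γ))
    lower-right = All.map (proj₁ ∘ proj₂) (All-boxesSE l (suc a) (suc γ))
    term : ∀ {z} → γ ≤ z →
      rowTail a z ⊗ belowSum a (suc γ) u (rowBoxes a (suc γ) z) (boxesSE l (suc a) (suc γ))
        ≈ (if z ≤ᵇ u then rowTail a z ⊗ gf m (suc a) γ z else 0#)
    term {z} γ≤z = begin
      rowTail a z ⊗ belowSum a (suc γ) u (rowBoxes a (suc γ) z) (boxesSE l (suc a) (suc γ))
        ≈⟨ *-congˡ (belowSum-rowBoxes a _ lower-right γ≤z γ≤u) ⟩
      rowTail a z ⊗ (if z ≤ᵇ u then boundedSum (suc γ) (suc a) z else 0#)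
        ≈⟨ *-if (z ≤ᵇ u) _ _ ⟩
      (if z ≤ᵇ u then rowTail a z ⊗ boundedSum (suc γ) (suc a) z else 0#)
        ≈⟨ if-cong (z ≤ᵇ u) (*-congˡ (boundedSum≈gf γ m (suc a) z (≡.trans (≡.sym (ℕₚ.+-suc a m)) a+m≡) (s≤s z≤n) γ≤z)) ⟩
      (if z ≤ᵇ u then rowTail a z ⊗ gf m (suc a) γ z else 0#) ∎

  BS≈gfRows-inLam : ∀ a γ → 1 ≤ a → inLam l a (suc γ) ≡ true → BS R l x a (suc γ) ≈ gfRows a (suc (columnLength l (suc γ))) γ
  BS≈gfRows-inLam a γ 1≤a a,γ+1∈λ = begin
    BS R l x a (suc γ)                               ≡⟨ if-true a,γ+1∈λ ⟩
    sumSubsets g (lamSE l a (suc γ))                 ≡⟨ ≡.cong (sumSubsets g) (lamSE≡boxesSE l 1≤a (s≤s z≤n)) ⟩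
    sumSubsets g (boxesSE l a (suc γ))               ≈⟨ sumSubsets-congᴬ (boxesSE l a (suc γ)) (All-boxesSE l a (suc γ))
                                                          (λ μ C μ-in → reflexive (≡.cong (λ b → if b ∧ isSubdiagram a (suc γ) μ then weight C else 0#)
                                                                                          (≡.sym (within μ-in)))) ⟩
    boundedSum (suc γ) a (row l a)                   ≈⟨ boundedSum≈gf γ (suc H ∸ a) a (row l a) (ℕₚ.m+[n∸m]≡n (ℕₚ.m≤n⇒m≤1+n a≤H)) 1≤a
                                                                      (ℕₚ.<⇒≤ γ<λₐ) ⟩
    gf (suc H ∸ a) a γ (row l a)                     ≡⟨ if-true (≤ᵇ-true (ℕₚ.m≤n⇒m≤1+n a≤H)) ⟨
    gfRows a (suc H) γ                               ∎
    where
    H : ℕ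
    H = columnLength l (suc γ)
    g : List Box × List Box → Carrier
    g (μ , C) = if isSubdiagram a (suc γ) μ then weight C else 0#
    γ<λₐ : suc γ ≤ row l a
    γ<λₐ = proj₂ (proj₂ (proj₂ (inLam⁻ l a (suc γ) a,γ+1∈λ)))
    a≤H : a ≤ H
    a≤H = ≤row⇒≤columnLength l l↓ (suc γ) 1≤a (proj₁ (proj₂ (inLam⁻ l a (suc γ) a,γ+1∈λ))) γ<λₐ
    within : ∀ {μ} → All (λ p → a ≤ proj₁ p × suc γ ≤ proj₂ p × proj₂ p ≤ row l (proj₁ p)) μ → columnsWithin (row l a) μ ≡ true
    within μ-in = all-true (All.map (λ (a≤r , _ , s≤λ) → ≤ᵇ-true (≤-trans s≤λ (row-antitone l l↓ 1≤a a≤r))) μ-in)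

  BS≈gfRows : ∀ a γ → 1 ≤ a → inStar l a (suc γ) ≡ true → BS R l x a (suc γ) ≈ gfRows a (suc (columnLength l γ)) γ
  BS≈gfRows a γ 1≤a a,γ+1∈λ* = byMembership (inLam l a (suc γ)) ≡.refl
    where
    byMembership : ∀ b → inLam l a (suc γ) ≡ b → BS R l x a (suc γ) ≈ gfRows a (suc (columnLength l γ)) γ
    byMembership true a,γ+1∈λ = begin
      BS R l x a (suc γ)                 ≈⟨ BS≈gfRows-inLam a γ 1≤a a,γ+1∈λ ⟩
      gfRows a (suc H) γ                 ≈⟨ gfRows-extendToColumnLength a γ H 1≤a (ℕₚ.m≤n⇒m≤1+n a≤H) (columnLength-antitone l (n≤1+n γ))
                                                                         (≤-pred ∘ row<-beyondColumnLength l l↓ γ) ⟨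
      gfRows a (suc (columnLength l γ)) γ ∎
      where
      H : ℕ
      H = columnLength l (suc γ)
      a≤H : a ≤ H
      a≤H with inLam⁻ l a (suc γ) a,γ+1∈λ
      ... | _ , a≤N , _ , γ<λₐ = ≤row⇒≤columnLength l l↓ (suc γ) 1≤a a≤N γ<λₐ
    byMembership false a,γ+1∉λ = begin
      BS R l x a (suc γ)                 ≡⟨ ≡.trans (if-false a,γ+1∉λ) (if-true a,γ+1∈λ*) ⟩
      1#                                 ≈⟨ gfRows-noRows a γ ⟨
      gfRows a a γ                       ≡⟨ ≡.cong (λ E → gfRows a E γ) (≡.sym 1+a′≡a) ⟩
      gfRows a (suc (a ∸ 1)) γ           ≈⟨ gfRows-extendToColumnLength a γ (a ∸ 1) 1≤a (ℕₚ.≤-reflexive (≡.sym 1+a′≡a))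
                                              (inStar⇒pred≤columnLength l l↓ {a} a,γ+1∈λ*)
                                              (λ {d} a′<d → ≤-trans (row-antitone l l↓ 1≤a (≡.subst (_≤ d) 1+a′≡a a′<d))
                                                                (¬inLam⇒row≤ l 1≤a a,γ+1∉λ)) ⟨
      gfRows a (suc (columnLength l γ)) γ ∎
      where
      1+a′≡a : suc (a ∸ 1) ≡ a
      1+a′≡a = ℕₚ.m+[n∸m]≡n 1≤a

  -- The monomials

  weight-boxesSE : ∀ a c → weight (boxesSE l a (suc c)) ≈ prodFrom (λ i → rowTail i c) a (suc (length l) ∸ a)
  weight-boxesSE a c = begin
    weight (concatMap (λ i → rowBoxes i (suc c) (row l i)) (fromTo a (length l)))   ≈⟨ weight-concatMap (fromTo a (length l)) ⟩
    prodL R (map (λ i → weight (rowBoxes i (suc c) (row l i))) (fromTo a (length l)))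
      ≡⟨ ≡.cong (prodL R) (Listₚ.map-cong (λ i → weight-rowBoxes i (suc c) (row l i)) (fromTo a (length l))) ⟩
    prodL R (map (λ i → rowTail i c) (fromTo a (length l)))                          ≡⟨ ≡.cong (prodL R ∘ map (λ i → rowTail i c)) (fromTo≡countFrom a (length l)) ⟩
    prodL R (map (λ i → rowTail i c) (countFrom a (suc (length l) ∸ a)))             ≡⟨ prodL-countFrom (λ i → rowTail i c) a (suc (length l) ∸ a) ⟩
    prodFrom (λ i → rowTail i c) a (suc (length l) ∸ a)                              ∎
    where
    weight-concatMap : ∀ is → weight (concatMap (λ i → rowBoxes i (suc c) (row l i)) is)
                              ≈ prodL R (map (λ i → weight (rowBoxes i (suc c) (row l i))) is)
    weight-concatMap [] = refl
    weight-concatMap (i ∷ is) = trans (weight-++ (rowBoxes i (suc c) (row l i)) _) (*-congˡ (weight-concatMap is))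

  -- the rows below row columnLength l c have empty tails beyond column c
  weight-lamSE≈prodFrom : ∀ r c → r ≤ columnLength l c →
    weight (lamSE l (suc r) (suc c)) ≈ prodFrom (λ d → rowTail d c) (suc r) (columnLength l c ∸ r)
  weight-lamSE≈prodFrom r c r≤D = begin
    weight (lamSE l (suc r) (suc c))                      ≡⟨ ≡.cong weight (lamSE≡boxesSE l (s≤s z≤n) (s≤s z≤n)) ⟩
    weight (boxesSE l (suc r) (suc c))                    ≈⟨ weight-boxesSE (suc r) c ⟩
    prodFrom V (suc r) (N ∸ r)                            ≡⟨ ≡.cong (prodFrom V (suc r)) N∸r≡ ⟩
    prodFrom V (suc r) ((D ∸ r) + (N ∸ D))                ≈⟨ prodFrom-+ (D ∸ r) (N ∸ D) (suc r) V ⟩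
    prodFrom V (suc r) (D ∸ r) ⊗ prodFrom V (suc D′) (N ∸ D) ≈⟨ *-congˡ (prodFrom-one (N ∸ D) _ V emptyTail) ⟩
    prodFrom V (suc r) (D ∸ r) ⊗ 1#                       ≈⟨ *-identityʳ _ ⟩
    prodFrom V (suc r) (D ∸ r)                            ∎
    where
    N D D′ : ℕ
    N = length l
    D = columnLength l c
    D′ = r + (D ∸ r)
    V : ℕ → Carrier
    V d = rowTail d c
    D≤N : D ≤ N
    D≤N = columnLength≤length l c
    D′≡D : D′ ≡ D
    D′≡D = ℕₚ.m+[n∸m]≡n r≤D
    N∸r≡ : N ∸ r ≡ (D ∸ r) + (N ∸ D)
    N∸r≡ = ≡.trans (≡.cong (_∸ r) (≡.sym N≡)) (ℕₚ.m+n∸m≡n r _)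
      where
      N≡ : r + ((D ∸ r) + (N ∸ D)) ≡ N
      N≡ = ≡.trans (≡.sym (ℕₚ.+-assoc r (D ∸ r) (N ∸ D))) (≡.trans (≡.cong (_+ (N ∸ D)) D′≡D) (ℕₚ.m+[n∸m]≡n D≤N))
    emptyTail : ∀ {i} → suc D′ ≤ i → i < suc D′ + (N ∸ D) → V i ≈ 1#
    emptyTail {i} D<i i≤N = reflexive (≡.cong (prodFrom (x i) (suc c)) (ℕₚ.m≤n⇒m∸n≡0 λᵢ≤c))
      where
      λᵢ≤c : row l i ≤ c
      λᵢ≤c with c ≤? row l i
      ... | no c≰λᵢ = ℕₚ.<⇒≤ (≰⇒> c≰λᵢ)
      ... | yes c≤λᵢ = ⊥-elim (ℕₚ.<⇒≱ (≡.subst (_< i) D′≡D D<i)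
                         (≤row⇒≤columnLength l l↓ c (≤-trans (s≤s z≤n) D<i)
                           (≤-pred (≡.subst (i <_) (≡.trans (≡.cong (λ m → suc m + (N ∸ D)) D′≡D) (≡.cong suc (ℕₚ.m+[n∸m]≡n D≤N))) i≤N)) c≤λᵢ))

  prod<-weight-lamSE≈thetaX : ∀ α β → prod< (nab l (suc α) (suc β)) (λ j → weight (lamSE l (suc α + j) (suc β + j))) ≈ thetaX R l x (suc α) (suc β)
  prod<-weight-lamSE≈thetaX α β = byMembership (inLam l (suc α) (suc β)) ≡.refl
    where
    n : ℕ
    n = nab l (suc α) (suc β)
    u : ℕ → Carrier
    u j = weight (lamSE l (suc α + j) (suc β + j))
    byMembership : ∀ b → inLam l (suc α) (suc β) ≡ b → prod< n u ≈ thetaX R l x (suc α) (suc β)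
    byMembership true ∈λ = trans (prod<≈prodL-upTo n u) (reflexive (≡.sym (if-true ∈λ)))
    byMembership false ∉λ = trans (prod<-one n u (λ {j} _ → reflexive (≡.cong weight (emptyCorner j)))) (reflexive (≡.sym (if-false ∉λ)))
      where
      λ₁₊α≤β : row l (suc α) < suc β
      λ₁₊α≤β with suc α ≤? length l | suc β ≤? row l (suc α)
      ... | no α≥N | _ = ≡.subst (_< suc β) (≡.sym (row-beyondLength l (≰⇒> α≥N))) (s≤s z≤n)
      ... | yes _ | no β≮λ = ≰⇒> β≮λ
      ... | yes α<N | yes β<λ with () ← ≡.trans (≡.sym (inLam⁺ l (s≤s z≤n) α<N (s≤s z≤n) β<λ)) ∉λ
      emptyCorner : ∀ j → lamSE l (suc α + j) (suc β + j) ≡ []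
      emptyCorner j = ≡.trans (lamSE≡boxesSE l (s≤s z≤n) (s≤s z≤n)) (boxesSE-empty l (suc α + j) (suc β + j) λ a≤i →
        ≤-<-trans (row-antitone l l↓ (s≤s z≤n) (≤-trans (m≤m+n (suc α) j) a≤i)) (≤-trans λ₁₊α≤β (m≤m+n (suc β) j)))

theorem2p4 : {c ℓ : Level} (R : CommutativeRing c ℓ) (l : List ℕ) → IsPartition l →
    (x : ℕ → ℕ → CommutativeRing.Carrier R) → (a b : ℕ) → inStar l a b ≡ true →
    CommutativeRing._≈_ R
      (det R (nab l a b) (λ i j → BS R l x (a + toℕ i) (b + toℕ j)))
      (thetaX R l x a b)
theorem2p4 R l _ x zero b ()
theorem2p4 R l _ x (suc α) zero corner with () ← proj₁ (proj₂ (proj₂ (inStar⁻ l (suc α) zero corner)))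
theorem2p4 R l (_ , _ , l↓) x (suc α) (suc β) corner = begin
  det R n (λ i j → BS R l x (suc α + toℕ i) (suc β + toℕ j))                  ≈⟨ det≈detℕ n _ _ (λ _ _ → refl) ⟩
  detℕ n (λ i j → BS R l x (suc α + i) (suc β + j))                           ≈⟨ detℕ-cong n (λ i<n j<n → BS≈gfRows _ _ (s≤s z≤n) (square-inStar i<n j<n)) ⟩
  detℕ n (λ i j → gfRows (suc α + i) (suc (columnLength l (β + j))) (β + j))  ≈⟨ det-gfRows≈prod-pivot ⟩
  prod< n pivot                                                                ≈⟨ prod<-cong n (λ j<n → sym (weight-lamSE≈prodFrom _ _ (diagonal≤columnLength j<n))) ⟩
  prod< n (λ j → weight (lamSE l (suc α + j) (suc β + j)))                    ≈⟨ prod<-weight-lamSE≈thetaX α β ⟩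
  thetaX R l x (suc α) (suc β)                                                 ∎
  where
  open CommutativeRing R using (refl; sym; setoid)
  open import Relation.Binary.Reasoning.Setoid setoid
  open FiniteSums R
  open Determinant R
  open LargestSquare l l↓ α β corner
  open BessenrodtStanley R l l↓ x
  open SquareReduction α β n rowsOfSquare-long rowBelowSquare-short diagonal≤columnLength
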